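{- For every integer $b\ge2$, the word $\mathbf v=S(\mathbf t_{b,2})$ is $R$-rich, and its factor complexity satisfies $\mathcal C_{\mathbf v}(n)=\frac12\,\mathcal C_{\mathbf t_{b,2}}(n+1)$ for all $n\ge1$.
   Context: $\mathbf t_{b,2}=(s_b(n)\bmod 2)_{n\ge0}$ where $s_b(n)$ is the sum of the base-$b$ digits of $n$. $S(u_0u_1\cdots)=v_1v_2\cdots$ with $v_i=(u_{i-1}+u_i)\bmod2$. $\mathcal C_{\mathbf x}(n)$ is the number of distinct factors of length $n$ of $\mathbf x$. For a finite word $w$, $D^R(w)=|w|+1-\#\mathrm{Pal}^R(w)$ where $\mathrm{Pal}^R(w)$ is the set of palindromic factors of $w$ including the empty word; an infinite word is $R$-rich if $D^R(w)=0$ for all its finite factors $w$. -}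

module Defs where

open import Data.Nat using (ℕ; zero; suc; _+_; _*_; _%_; _/_; NonZero)
open import Data.List using (List; []; _∷_; length; reverse; _++_)
open import Data.List.Membership.Propositional using (_∈_)
open import Data.List.Relation.Unary.Unique.Propositional using (Unique)
open import Data.Product using (Σ; ∃; _×_)
open import Relation.Binary.PropositionalEquality using (_≡_)
open import Function.Bundles using (_⇔_)

-- Infinite words over the alphabet {0,1} ⊂ ℕ, indexed from 0.
Word∞ : Set
Word∞ = ℕ → ℕ

Word : Set
Word = List ℕ

-- Sum of base-b digits, with fuel (fuel n suffices since n / b < n for b ≥ 2, n > 0).
digitSumFuel : (b : ℕ) → .{{NonZero b}} → ℕ → ℕ → ℕ
digitSumFuel b zero    n = 0
digitSumFuel b (suc f) n = n % b + digitSumFuel b f (n / b)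

digitSum : (b : ℕ) → .{{NonZero b}} → ℕ → ℕ
digitSum b n = digitSumFuel b n n

tb2 : (b : ℕ) → .{{NonZero b}} → Word∞
tb2 b n = digitSum b n % 2

-- S(u_0 u_1 ⋯) = v_1 v_2 ⋯ with v_i = (u_{i-1} + u_i) mod 2 (reindexed from 0).
S : Word∞ → Word∞
S u n = (u n + u (suc n)) % 2

slice : Word∞ → ℕ → ℕ → Word
slice x i zero    = []
slice x i (suc n) = x i ∷ slice x (suc i) n

IsFactor∞ : Word → Word∞ → Set
IsFactor∞ w x = ∃ λ i → slice x i (length w) ≡ w

IsFactor : Word → Word → Set
IsFactor v w = ∃ λ p → ∃ λ s → p ++ v ++ s ≡ w

IsPal : Word → Set
IsPal w = reverse w ≡ w

Complexity : Word∞ → ℕ → ℕ → Set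
Complexity x n k =
  Σ (List Word) λ L → Unique L × length L ≡ k ×
    (∀ w → (w ∈ L) ⇔ (length w ≡ n × IsFactor∞ w x))

-- #Pal^R(w) = k : the palindromic factors of w (including the empty word) are exactly k distinct words.
PalCount : Word → ℕ → Set
PalCount w k =
  Σ (List Word) λ L → Unique L × length L ≡ k ×
    (∀ v → (v ∈ L) ⇔ (IsFactor v w × IsPal v))

DefectZero : Word → Set
DefectZero w = PalCount w (length w + 1)

RRich : Word∞ → Set
RRich x = ∀ w → IsFactor∞ w x → DefectZero w

-- Write b = d + 2 and c = b − 1. Since s_b(b n + j) = j + s_b(n), the word v = S(t_{b,2}) satisfies
-- v(b n + j) = 1 for j < c and v(b n + c) ≡ c + s_b(n) + s_b(n + 1) (mod 2).  For odd b the letter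
-- v(b n + c) equals v(n), so v is constantly 1; for even b it is 1 − v(n), so v is a generalised
-- period-doubling word.
-- Richness: when every complete return to a palindrome is a palindrome, each prefix gains exactly one
-- new palindrome (its longest palindromic suffix).  For a period-doubling word this return property is
-- proved by induction on the length of the palindrome: palindromes containing a 0 are images of
-- shorter palindromes under the substitution, and blocks of ones are handled directly.
-- Complexity: a factor of t of length n + 1 is determined by its first letter and its image under S,
-- and adding a large power b^K complements t on any window, so both first letters always occur.

module Submission where

open import Defs
open import Data.Empty using (⊥; ⊥-elim)
open import Data.List using (List; []; _∷_; length; reverse; _++_; [_]; map; upTo; deduplicate)
open import Data.List.Membership.Propositional using (_∈_)
open import Data.List.Membership.Propositional.Properties
  using (∈-++⁻; ∈-++⁺ˡ; ∈-++⁺ʳ; ∈-map⁺; ∈-map⁻; ∈-upTo⁺; ∈-deduplicate⁺; ∈-deduplicate⁻)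
open import Data.List.Properties using (length-++; length-map; ≡-dec; reverse-++; ∷-injectiveˡ; ∷-injectiveʳ)
open import Data.List.Relation.Unary.All using (All; []; _∷_)
import Data.List.Relation.Unary.All as All
import Data.List.Relation.Unary.All.Properties as All
open import Data.List.Relation.Unary.AllPairs using ([]; _∷_)
open import Data.List.Relation.Unary.Any using (here; there)
open import Data.List.Relation.Unary.Unique.DecPropositional.Properties using (deduplicate-!)
open import Data.List.Relation.Unary.Unique.Propositional using (Unique)
open import Data.List.Relation.Unary.Unique.Propositional.Properties using (++⁺)
open import Data.Nat
open import Data.Nat.DivMod
open import Data.Nat.Induction using (<-rec)
open import Data.Nat.Properties
open import Data.Nat.Tactic.RingSolver
open import Data.Product hiding (map)
open import Data.Sum hiding (map)
open import Function using (id)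
open import Function.Bundles using (_⇔_; mk⇔; Equivalence)
open import Relation.Binary.Definitions using (tri<; tri≈; tri>)
open import Relation.Binary.PropositionalEquality hiding ([_])
open import Relation.Nullary using (Dec; yes; no; ¬_)
open import Relation.Unary using (Decidable)

abstract
  least : {P : ℕ → Set} → Decidable P → ∀ n → P n →
    ∃ λ m → m ≤ n × P m × (∀ k → k < m → ¬ P k)
  least {P} P? n pn with search n
    where
    search : ∀ n → (∃ λ m → m ≤ n × P m × (∀ k → k < m → ¬ P k)) ⊎ (∀ k → k ≤ n → ¬ P k)
    search zero with P? zero
    ... | yes p = inj₁ (zero , z≤n , p , λ _ ())
    ... | no ¬p = inj₂ λ { zero _ → ¬p }
    search (suc n) with search n | P? (suc n)
    ... | inj₁ (m , m≤n , pm , below) | _ = inj₁ (m , m≤n⇒m≤1+n m≤n , pm , below)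
    ... | inj₂ none | yes p = inj₁ (suc n , ≤-refl , p , λ k k≤n → none k (≤-pred k≤n))
    ... | inj₂ none | no ¬p = inj₂ λ k k≤1+n → [ (λ k<1+n → none k (≤-pred k<1+n)) , (λ { refl → ¬p }) ]′
                                                  (m≤n⇒m<n∨m≡n k≤1+n)
  ... | inj₁ found = found
  ... | inj₂ none = ⊥-elim (none n ≤-refl pn)

  greatestBelow : {Q : ℕ → Set} → Decidable Q → ∀ a p → p < a → Q p →
    ∃ λ q → p ≤ q × q < a × Q q × (∀ k → q < k → k < a → ¬ Q k)
  greatestBelow {Q} Q? (suc a) p p<1+a qp with Q? a | m≤n⇒m<n∨m≡n (≤-pred p<1+a)
  ... | yes qa | _ = a , ≤-pred p<1+a , ≤-refl , qa , λ k a<k k<1+a _ → <-irrefl refl (≤-trans k<1+a a<k)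
  ... | no ¬qa | inj₂ refl = ⊥-elim (¬qa qp)
  ... | no ¬qa | inj₁ p<a with greatestBelow Q? a p p<a qp
  ...   | q , p≤q , q<a , qq , none = q , p≤q , m≤n⇒m≤1+n q<a , qq , none′
    where
    none′ : ∀ k → q < k → k < suc a → ¬ Q k
    none′ k q<k k<1+a = [ none k q<k , (λ { refl → ¬qa }) ]′ (m≤n⇒m<n∨m≡n (≤-pred k<1+a))

-- Palindromes in windows of infinite words

SameFactor : Word∞ → ℕ → ℕ → ℕ → Set
SameFactor x i j L = ∀ k → k < L → x (i + k) ≡ x (j + k)

PalindromeOn : Word∞ → ℕ → ℕ → Set
PalindromeOn x lo hi = ∀ p q → lo ≤ p → lo ≤ q → p + q ≡ lo + hi → x p ≡ x q

NoOccurrenceBetween : Word∞ → ℕ → ℕ → ℕ → Set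
NoOccurrenceBetween x i j L = ∀ k → i < k → k < j → ¬ SameFactor x i k L

length-slice : ∀ x i L → length (slice x i L) ≡ L
length-slice x i zero    = refl
length-slice x i (suc L) = cong suc (length-slice x (suc i) L)

IsFactor∞-slice : ∀ {x i n w} → slice x i n ≡ w → IsFactor∞ w x
IsFactor∞-slice {x} {i} {n} refl = i , cong (slice x i) (length-slice x i n)

SameFactor⇒slice≡ : ∀ x i j L → SameFactor x i j L → slice x i L ≡ slice x j L
SameFactor⇒slice≡ x i j zero    same = refl
SameFactor⇒slice≡ x i j (suc L) same = cong₂ _∷_ head (SameFactor⇒slice≡ x (suc i) (suc j) L tail)
  where
  head : x i ≡ x j
  head = subst₂ (λ p q → x p ≡ x q) (+-identityʳ i) (+-identityʳ j) (same 0 z<s)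
  tail : SameFactor x (suc i) (suc j) L
  tail k k<L = subst₂ (λ p q → x p ≡ x q) (+-suc i k) (+-suc j k) (same (suc k) (s≤s k<L))

slice≡⇒SameFactor : ∀ x i j L → slice x i L ≡ slice x j L → SameFactor x i j L
slice≡⇒SameFactor x i j (suc L) eq zero _ =
  subst₂ (λ p q → x p ≡ x q) (sym (+-identityʳ i)) (sym (+-identityʳ j)) (∷-injectiveˡ eq)
slice≡⇒SameFactor x i j (suc L) eq (suc k) (s≤s k<L) =
  subst₂ (λ p q → x p ≡ x q) (sym (+-suc i k)) (sym (+-suc j k))
    (slice≡⇒SameFactor x (suc i) (suc j) L (∷-injectiveʳ eq) k k<L)

slice-++ : ∀ x i m n → slice x i (m + n) ≡ slice x i m ++ slice x (i + m) n
slice-++ x i zero    n = cong (λ z → slice x z n) (sym (+-identityʳ i))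
slice-++ x i (suc m) n = cong (x i ∷_)
  (trans (slice-++ x (suc i) m n) (cong (λ z → slice x (suc i) m ++ slice x z n) (sym (+-suc i m))))

reversedSlice : Word∞ → ℕ → ℕ → Word
reversedSlice x a zero    = []
reversedSlice x a (suc L) = x (a + L) ∷ reversedSlice x a L

reverse-slice : ∀ x a L → reverse (slice x a L) ≡ reversedSlice x a L
reverse-slice x a zero    = refl
reverse-slice x a (suc L) = begin
  reverse (slice x a (suc L))                  ≡⟨ cong reverse (trans (cong (slice x a) (+-comm 1 L)) (slice-++ x a L 1)) ⟩
  reverse (slice x a L ++ [ x (a + L) ])        ≡⟨ reverse-++ (slice x a L) [ x (a + L) ] ⟩
  x (a + L) ∷ reverse (slice x a L)            ≡⟨ cong (x (a + L) ∷_) (reverse-slice x a L) ⟩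
  reversedSlice x a (suc L)                    ∎
  where open ≡-Reasoning

-- Lookup with junk value 0 past the end.
at : Word → ℕ → ℕ
at []       k       = 0
at (y ∷ ys) zero    = y
at (y ∷ ys) (suc k) = at ys k

at-ext : ∀ (xs ys : Word) → length xs ≡ length ys → (∀ k → k < length xs → at xs k ≡ at ys k) → xs ≡ ys
at-ext []       []       _   _ = refl
at-ext (x ∷ xs) (y ∷ ys) len h =
  cong₂ _∷_ (h 0 z<s) (at-ext xs ys (suc-injective len) λ k k< → h (suc k) (s≤s k<))

at-slice : ∀ x a L k → k < L → at (slice x a L) k ≡ x (a + k)
at-slice x a (suc L) zero    _         = cong x (sym (+-identityʳ a))
at-slice x a (suc L) (suc k) (s≤s k<L) = trans (at-slice x (suc a) L k k<L) (cong x (sym (+-suc a k)))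

at-reversedSlice : ∀ x a L k → k < L → at (reversedSlice x a L) k ≡ x (a + (L ∸ suc k))
at-reversedSlice x a (suc L) zero    _         = refl
at-reversedSlice x a (suc L) (suc k) (s≤s k<L) = at-reversedSlice x a L k k<L

length-reversedSlice : ∀ x a L → length (reversedSlice x a L) ≡ L
length-reversedSlice x a zero    = refl
length-reversedSlice x a (suc L) = cong suc (length-reversedSlice x a L)

IsPal? : ∀ w → Dec (IsPal w)
IsPal? w = ≡-dec _≟_ (reverse w) w

IsPal-slice⇒mirror : ∀ x a L → IsPal (slice x a L) → ∀ k → k < L → x (a + (L ∸ suc k)) ≡ x (a + k)
IsPal-slice⇒mirror x a L pal k k<L = begin
  x (a + (L ∸ suc k))            ≡⟨ at-reversedSlice x a L k k<L ⟨
  at (reversedSlice x a L) k     ≡⟨ cong (λ w → at w k) (reverse-slice x a L) ⟨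
  at (reverse (slice x a L)) k   ≡⟨ cong (λ w → at w k) pal ⟩
  at (slice x a L) k             ≡⟨ at-slice x a L k k<L ⟩
  x (a + k)                      ∎
  where open ≡-Reasoning

mirror⇒IsPal-slice : ∀ x a L → (∀ k → k < L → x (a + (L ∸ suc k)) ≡ x (a + k)) → IsPal (slice x a L)
mirror⇒IsPal-slice x a L mirror = trans (reverse-slice x a L)
  (at-ext (reversedSlice x a L) (slice x a L) (trans (length-reversedSlice x a L) (sym (length-slice x a L)))
    λ k k< → let k<L = subst (k <_) (length-reversedSlice x a L) k< in
      trans (at-reversedSlice x a L k k<L) (trans (mirror k k<L) (sym (at-slice x a L k k<L))))

PalindromeOn⇒IsPal : ∀ x a ℓ → PalindromeOn x a (a + ℓ) → IsPal (slice x a (suc ℓ))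
PalindromeOn⇒IsPal x a ℓ pal = mirror⇒IsPal-slice x a (suc ℓ) λ k k<1+ℓ →
  pal (a + (ℓ ∸ k)) (a + k) (m≤m+n a _) (m≤m+n a k) (sum k (≤-pred k<1+ℓ))
  where
  sum : ∀ k → k ≤ ℓ → a + (ℓ ∸ k) + (a + k) ≡ a + (a + ℓ)
  sum k k≤ℓ = trans (rearrange a (ℓ ∸ k) k) (cong (λ z → a + (a + z)) (m∸n+n≡m k≤ℓ))
    where
    rearrange : ∀ a u k → a + u + (a + k) ≡ a + (a + (u + k))
    rearrange = solve-∀

IsPal⇒PalindromeOn : ∀ x a ℓ → IsPal (slice x a (suc ℓ)) → PalindromeOn x a (a + ℓ)
IsPal⇒PalindromeOn x a ℓ pal p q a≤p a≤q sum with m≤n⇒∃[o]m+o≡n a≤p | m≤n⇒∃[o]m+o≡n a≤q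
... | k , refl | k′ , refl =
  sym (trans (cong (λ z → x (a + z)) k′≡ℓ∸k) (IsPal-slice⇒mirror x a (suc ℓ) pal k (s≤s k≤ℓ)))
  where
  rearrange : ∀ a k k′ → a + k + (a + k′) ≡ a + (a + (k + k′))
  rearrange = solve-∀
  k+k′≡ℓ : k + k′ ≡ ℓ
  k+k′≡ℓ = +-cancelˡ-≡ a _ _ (+-cancelˡ-≡ a _ _ (trans (sym (rearrange a k k′)) sum))
  k≤ℓ : k ≤ ℓ
  k≤ℓ = subst (k ≤_) k+k′≡ℓ (m≤m+n k k′)
  k′≡ℓ∸k : k′ ≡ ℓ ∸ k
  k′≡ℓ∸k = sym (trans (cong (_∸ k) (sym k+k′≡ℓ)) (m+n∸m≡n k k′))

mirror-≤ : ∀ {p q lo hi} → p + q ≡ lo + hi → lo ≤ q → p ≤ hi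
mirror-≤ {p} {q} {lo} {hi} sum lo≤q =
  +-cancelʳ-≤ lo p hi (≤-trans (+-monoʳ-≤ p lo≤q) (≤-reflexive (trans sum (+-comm lo hi))))

PalindromeOn-constant : ∀ x lo hi a → (∀ p → lo ≤ p → p ≤ hi → x p ≡ a) → PalindromeOn x lo hi
PalindromeOn-constant x lo hi a const p q lo≤p lo≤q sum =
  trans (const p lo≤p (mirror-≤ sum lo≤q)) (sym (const q lo≤q (mirror-≤ (trans (+-comm q p) sum) lo≤p)))

PalindromeOn-letter : ∀ x n → PalindromeOn x n n
PalindromeOn-letter x n = PalindromeOn-constant x n n (x n) λ p n≤p p≤n → cong x (≤-antisym p≤n n≤p)

PalindromeOn-framed : ∀ x lo hi a → x lo ≡ x hi → (∀ p → lo < p → p < hi → x p ≡ a) → PalindromeOn x lo hi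
PalindromeOn-framed x lo hi a ends inner p q lo≤p lo≤q sum with m≤n⇒m<n∨m≡n lo≤p | m≤n⇒m<n∨m≡n lo≤q
... | inj₂ refl | _         = trans ends (cong x (+-cancelˡ-≡ lo hi q (sym sum)))
... | _         | inj₂ refl = trans (cong x (+-cancelʳ-≡ lo p hi (trans sum (+-comm lo hi)))) (sym ends)
... | inj₁ lo<p | inj₁ lo<q = trans (inner p lo<p (below lo<q sum)) (sym (inner q lo<q (below lo<p (trans (+-comm q p) sum))))
  where
  below : ∀ {p q} → lo < q → p + q ≡ lo + hi → p < hi
  below {p} {q} lo<q sum = +-cancelʳ-< lo p hi (≤-trans (+-monoʳ-< p lo<q) (≤-reflexive (trans sum (+-comm lo hi))))

abstract
  division : ∀ P .{{_ : NonZero P}} p → ∃₂ λ q r → r < P × p ≡ P * q + r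
  division P p = p / P , p % P , m%n<n p P ,
    trans (m≡m%n+[m/n]*n p P) (trans (+-comm (p % P) _) (cong (_+ p % P) (*-comm (p / P) P)))

-- Richness from complete returns

OccursIn : Word∞ → ℕ → ℕ → Word → Set
OccursIn x i N u = ∃ λ p → p + length u ≤ N × slice x (i + p) (length u) ≡ u

split-slice : ∀ (x : Word∞) (ys zs : Word) i N → ys ++ zs ≡ slice x i N →
  ∃ λ m → length ys + m ≡ N × ys ≡ slice x i (length ys) × zs ≡ slice x (i + length ys) m
split-slice x []       zs i N       eq = N , refl , refl , trans eq (cong (λ z → slice x z N) (sym (+-identityʳ i)))
split-slice x (y ∷ ys) zs i (suc N) eq with split-slice x ys zs (suc i) N (∷-injectiveʳ eq)
... | m , len , ys≡ , zs≡ = m , cong suc len , cong₂ _∷_ (∷-injectiveˡ eq) ys≡ ,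
  trans zs≡ (cong (λ z → slice x z m) (sym (+-suc i (length ys))))

IsFactor-slice⇒OccursIn : ∀ x i N u → IsFactor u (slice x i N) → OccursIn x i N u
IsFactor-slice⇒OccursIn x i N u (p , s , eq) with split-slice x p (u ++ s) i N eq
... | m , len-p , _ , rest with split-slice x u s (i + length p) m rest
...   | _ , len-u , u≡ , _ =
  length p , subst (length p + length u ≤_) (trans (cong (length p +_) len-u) len-p)
                   (+-monoʳ-≤ (length p) (m≤m+n (length u) _)) ,
  sym u≡

OccursIn⇒IsFactor-slice : ∀ x i N u → OccursIn x i N u → IsFactor u (slice x i N)
OccursIn⇒IsFactor-slice x i N u (p , fits , eq) =
  slice x i p , slice x (i + p + length u) r , sym (begin
    slice x i N                                                            ≡⟨ cong (slice x i) N≡ ⟨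
    slice x i (p + (length u + r))                                         ≡⟨ slice-++ x i p (length u + r) ⟩
    slice x i p ++ slice x (i + p) (length u + r)                          ≡⟨ cong (slice x i p ++_) (slice-++ x (i + p) (length u) r) ⟩
    slice x i p ++ slice x (i + p) (length u) ++ slice x (i + p + length u) r ≡⟨ cong (λ z → slice x i p ++ z ++ slice x (i + p + length u) r) eq ⟩
    slice x i p ++ u ++ slice x (i + p + length u) r                       ∎)
  where
  open ≡-Reasoning
  r : ℕ
  r = N ∸ (p + length u)
  N≡ : p + (length u + r) ≡ N
  N≡ = trans (sym (+-assoc p (length u) r)) (m+[n∸m]≡n fits)

CompleteReturnsPalindromic : Word∞ → Set
CompleteReturnsPalindromic x = ∀ i j ℓ → i < j → SameFactor x i j (suc ℓ) → PalindromeOn x i (i + ℓ) →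
  NoOccurrenceBetween x i j (suc ℓ) → PalindromeOn x i (j + ℓ)

suffix-palindrome-occurs-at-start : ∀ x A B ℓ m → PalindromeOn x A (A + ℓ) → PalindromeOn x B (B + m) →
  A ≤ B → B + m ≡ A + ℓ → SameFactor x A B (suc m)
suffix-palindrome-occurs-at-start x A B ℓ m outer inner A≤B end k k<1+m =
  trans (outer (A + k) (B + k′) (m≤m+n A k) (≤-trans A≤B (m≤m+n B k′)) outer-sum)
        (inner (B + k′) (B + k) (m≤m+n B k′) (m≤m+n B k) inner-sum)
  where
  k′ : ℕ
  k′ = m ∸ k
  k+k′≡m : k + k′ ≡ m
  k+k′≡m = m+[n∸m]≡n (≤-pred k<1+m)
  rearrange : ∀ A B k k′ → A + k + (B + k′) ≡ A + (B + (k + k′))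
  rearrange = solve-∀
  outer-sum : A + k + (B + k′) ≡ A + (A + ℓ)
  outer-sum = trans (rearrange A B k k′) (trans (cong (λ z → A + (B + z)) k+k′≡m) (cong (A +_) end))
  inner-sum : B + k′ + (B + k) ≡ B + (B + m)
  inner-sum = trans (trans (+-comm (B + k′) (B + k)) (rearrange B B k k′)) (cong (λ z → B + (B + z)) k+k′≡m)

module PrefixPalindromes (x : Word∞) (returns : CompleteReturnsPalindromic x) (i : ℕ) where

  PalindromesOfPrefix : ℕ → List Word → Set
  PalindromesOfPrefix N L = Unique L × length L ≡ N + 1 × (∀ u → (u ∈ L) ⇔ (OccursIn x i N u × IsPal u))

  empty-prefix : PalindromesOfPrefix 0 ([] ∷ [])
  empty-prefix = ([] ∷ []) , refl , λ u → mk⇔ (to u) (from u)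
    where
    to : ∀ u → u ∈ ([] ∷ []) → OccursIn x i 0 u × IsPal u
    to .[] (here refl) = (0 , z≤n , refl) , refl
    from : ∀ u → OccursIn x i 0 u × IsPal u → u ∈ ([] ∷ [])
    from []      _                     = here refl
    from (_ ∷ u) ((p , fits , _) , _) with m+n≤o⇒n≤o p fits
    ... | ()

  -- x_{i+a} ⋯ x_{i+N} is a palindrome: a suffix of the prefix of length N + 1, not N.
  PalSuffix : ℕ → ℕ → Set
  PalSuffix N a = IsPal (slice x (i + a) (suc (N ∸ a)))

  module _ (N : ℕ) where

    longestPalSuffix : ∃ λ a → a ≤ N × PalSuffix N a × (∀ k → k < a → ¬ PalSuffix N k)
    longestPalSuffix = least (λ a → IsPal? _) N (subst (λ n → IsPal (slice x (i + N) (suc n))) (sym (n∸n≡0 N)) refl)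

    a : ℕ
    a = proj₁ longestPalSuffix

    ℓ : ℕ
    ℓ = N ∸ a

    lps : Word
    lps = slice x (i + a) (suc ℓ)

    a≤N : a ≤ N
    a≤N = proj₁ (proj₂ longestPalSuffix)

    lps-pal : PalSuffix N a
    lps-pal = proj₁ (proj₂ (proj₂ longestPalSuffix))

    lps-longest : ∀ k → k < a → ¬ PalSuffix N k
    lps-longest = proj₂ (proj₂ (proj₂ longestPalSuffix))

    a+ℓ≡N : a + ℓ ≡ N
    a+ℓ≡N = m+[n∸m]≡n a≤N

    length-lps : length lps ≡ suc ℓ
    length-lps = length-slice x (i + a) (suc ℓ)

    -- The last earlier occurrence of lps is followed by a complete return to it,
    -- which is a palindrome and hence a longer palindromic suffix.
    lps-unioccurrent : ¬ OccursIn x i N lps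
    lps-unioccurrent (p , fits , occ) with greatestBelow (λ k → ≡-dec _≟_ (slice x (i + k) (suc ℓ)) lps) a p p<a occ′
      where
      p<a : p < a
      p<a = +-cancelʳ-≤ ℓ (suc p) a (subst (suc p + ℓ ≤_) (sym a+ℓ≡N)
              (subst (_≤ N) (+-suc p ℓ) (subst (λ z → p + z ≤ N) length-lps fits)))
      occ′ : slice x (i + p) (suc ℓ) ≡ lps
      occ′ = subst (λ z → slice x (i + p) z ≡ lps) length-lps occ
    ... | q , _ , q<a , occ-q , no-later = lps-longest q q<a longer
      where
      none : NoOccurrenceBetween x (i + q) (i + a) (suc ℓ)
      none k q<k k<a same with m≤n⇒∃[o]m+o≡n (≤-trans (m≤m+n i q) (<⇒≤ q<k))
      ... | k′ , refl = no-later k′ (+-cancelˡ-< i q k′ q<k) (+-cancelˡ-< i k′ a k<a)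
                          (trans (sym (SameFactor⇒slice≡ x (i + q) (i + k′) (suc ℓ) same)) occ-q)
      return : PalindromeOn x (i + q) (i + a + ℓ)
      return = returns (i + q) (i + a) ℓ (+-monoʳ-< i q<a)
                 (slice≡⇒SameFactor x (i + q) (i + a) (suc ℓ) occ-q)
                 (IsPal⇒PalindromeOn x (i + q) ℓ (subst IsPal (sym occ-q) lps-pal)) none
      end : i + a + ℓ ≡ i + q + (N ∸ q)
      end = trans (+-assoc i a ℓ) (trans (cong (i +_) (trans a+ℓ≡N (sym (m+[n∸m]≡n (≤-trans (<⇒≤ q<a) a≤N)))))
              (sym (+-assoc i q (N ∸ q))))
      longer : PalSuffix N q
      longer = PalindromeOn⇒IsPal x (i + q) (N ∸ q) (subst (PalindromeOn x (i + q)) end return)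

    -- A palindrome ending at N other than lps is a proper suffix of lps, hence also its prefix.
    palSuffix-occurs-earlier : ∀ p m → p + suc m ≡ suc N → a < p → IsPal (slice x (i + p) (suc m)) →
      OccursIn x i N (slice x (i + p) (suc m))
    palSuffix-occurs-earlier p m end a<p pal =
      a , fits , trans (cong (slice x (i + a)) (length-slice x (i + p) (suc m)))
                       (SameFactor⇒slice≡ x (i + a) (i + p) (suc m)
                         (suffix-palindrome-occurs-at-start x (i + a) (i + p) ℓ m
                           (IsPal⇒PalindromeOn x (i + a) ℓ lps-pal) (IsPal⇒PalindromeOn x (i + p) m pal)
                           (+-monoʳ-≤ i (<⇒≤ a<p)) same-end))
      where
      p+m≡N : p + m ≡ N
      p+m≡N = suc-injective (trans (sym (+-suc p m)) end)
      fits : a + length (slice x (i + p) (suc m)) ≤ N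
      fits = subst (λ z → a + z ≤ N) (sym (length-slice x (i + p) (suc m)))
               (≤-pred (subst (suc a + suc m ≤_) end (+-monoˡ-≤ (suc m) a<p)))
      same-end : i + p + m ≡ i + a + ℓ
      same-end = trans (+-assoc i p m) (trans (cong (i +_) (trans p+m≡N (sym a+ℓ≡N))) (sym (+-assoc i a ℓ)))

  extend-prefix : ∀ N L → PalindromesOfPrefix N L → PalindromesOfPrefix (suc N) (L ++ [ lps N ])
  extend-prefix N L (unique , len , iff) = unique′ , len′ , λ u → mk⇔ (to u) (from u)
    where
    unique′ : Unique (L ++ [ lps N ])
    unique′ = ++⁺ unique ([] ∷ []) λ { (v∈L , here refl) → lps-unioccurrent N (proj₁ (Equivalence.to (iff _) v∈L)) }
    len′ : length (L ++ [ lps N ]) ≡ suc N + 1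
    len′ = trans (length-++ L) (trans (+-comm (length L) 1) (cong suc len))
    to : ∀ u → u ∈ L ++ [ lps N ] → OccursIn x i (suc N) u × IsPal u
    to u u∈ with ∈-++⁻ L u∈
    ... | inj₁ u∈L with Equivalence.to (iff u) u∈L
    ...   | (p , fits , occ) , pal = (p , m≤n⇒m≤1+n fits , occ) , pal
    to u u∈ | inj₂ (here refl) = (a N , fits , cong (slice x (i + a N)) (length-lps N)) , lps-pal N
      where
      fits : a N + length (lps N) ≤ suc N
      fits = subst (λ z → a N + z ≤ suc N) (sym (length-lps N))
               (≤-reflexive (trans (+-suc (a N) (ℓ N)) (cong suc (a+ℓ≡N N))))
    from : ∀ u → OccursIn x i (suc N) u × IsPal u → u ∈ L ++ [ lps N ]
    from []            _ = ∈-++⁺ˡ (Equivalence.from (iff []) ((0 , z≤n , refl) , refl))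
    from u@(_ ∷ ys) ((p , fits , occ) , pal) with p + length u ≤? N
    ... | yes fits′ = ∈-++⁺ˡ (Equivalence.from (iff u) ((p , fits′ , occ) , pal))
    ... | no ¬fits′ = suffix-in-list (≤-antisym fits (≰⇒> ¬fits′))
      where
      suffix-in-list : p + suc (length ys) ≡ suc N → u ∈ L ++ [ lps N ]
      suffix-in-list end = placed (m≤n⇒m<n∨m≡n (≮⇒≥ (λ p<a → lps-longest N p p<a pal′)))
        where
        m≡ : length ys ≡ N ∸ p
        m≡ = sym (trans (cong (_∸ p) (sym (suc-injective (trans (sym (+-suc p _)) end)))) (m+n∸m≡n p _))
        pal′ : PalSuffix N p
        pal′ = subst (λ z → IsPal (slice x (i + p) (suc z))) m≡ (subst IsPal (sym occ) pal)
        placed : a N < p ⊎ a N ≡ p → u ∈ L ++ [ lps N ]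
        placed (inj₂ refl) = ∈-++⁺ʳ L (here (trans (sym occ) (cong (λ z → slice x (i + p) (suc z)) m≡)))
        placed (inj₁ a<p)  = ∈-++⁺ˡ (Equivalence.from (iff u)
                               (subst (OccursIn x i N) occ (palSuffix-occurs-earlier N p (length ys) end a<p
                                 (subst IsPal (sym occ) pal)) , pal))

  palindromesOfPrefix : ∀ N → ∃ (PalindromesOfPrefix N)
  palindromesOfPrefix zero    = _ , empty-prefix
  palindromesOfPrefix (suc N) = _ , extend-prefix N _ (proj₂ (palindromesOfPrefix N))

  prefix-palCount : ∀ N → PalCount (slice x i N) (N + 1)
  prefix-palCount N with palindromesOfPrefix N
  ... | L , unique , len , iff = L , unique , len , λ u → mk⇔
    (λ u∈ → let (occ , pal) = Equivalence.to (iff u) u∈ in OccursIn⇒IsFactor-slice x i N u occ , pal)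
    (λ (fac , pal) → Equivalence.from (iff u) (IsFactor-slice⇒OccursIn x i N u fac , pal))

complete-returns⇒rich : ∀ x → CompleteReturnsPalindromic x → RRich x
complete-returns⇒rich x returns w (i , occ) =
  subst (λ u → PalCount u (length w + 1)) occ (PrefixPalindromes.prefix-palCount x returns i (length w))

-- Generalised period-doubling words

OccursBefore : Word∞ → ℕ → ℕ → Set
OccursBefore x m bound = ∀ i → ∃ λ i′ → i′ < bound × SameFactor x i i′ m

-- Here b = d + 2 and c = b − 1.  For b = 2 this is the period-doubling word with its letters exchanged.
record PeriodDoubling (d : ℕ) (x : Word∞) : Set where
  field
    block-ones : ∀ n j → j < suc d → x (suc (suc d) * n + j) ≡ 1
    hole-flips : ∀ n → x (suc (suc d) * n + suc d) + x n ≡ 1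

n<[2+d]^n : ∀ d n → n < suc (suc d) ^ n
n<[2+d]^n d zero    = z<s
n<[2+d]^n d (suc n) = ≤-trans (s≤s (n<[2+d]^n d n))
  (≤-trans (+-monoˡ-≤ P (m^n>0 (suc (suc d)) n)) (+-monoʳ-≤ P (m≤m+n P (d * P))))
  where P = suc (suc d) ^ n

module PeriodDoublingWord {d : ℕ} {x : Word∞} (pd : PeriodDoubling d x) where

  open PeriodDoubling pd public

  c : ℕ
  c = suc d

  b : ℕ
  b = suc c

  hole : ℕ → ℕ
  hole n = b * n + c

  hole-mono-≤ : ∀ {n n′} → n ≤ n′ → hole n ≤ hole n′
  hole-mono-≤ n≤n′ = +-monoˡ-≤ c (*-monoʳ-≤ b n≤n′)

  hole-zero : hole 0 ≡ c
  hole-zero = cong (_+ c) (*-zeroʳ b)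

  hole-suc : ∀ n → hole (suc n) ≡ hole n + b
  hole-suc n = rearrange b n c
    where
    rearrange : ∀ b n c → b * suc n + c ≡ b * n + c + b
    rearrange = solve-∀

  hole-+ : ∀ n e → hole (n + e) ≡ hole n + b * e
  hole-+ n e = rearrange b n e c
    where
    rearrange : ∀ b n e c → b * (n + e) + c ≡ b * n + c + b * e
    rearrange = solve-∀

  shift-blocks : ∀ a e t n r → a + t ≡ b * n + r → a + b * e + t ≡ b * (n + e) + r
  shift-blocks a e t n r eq = trans (exchange a (b * e) t) (trans (cong (_+ b * e) eq) (collect b n e r))
    where
    exchange : ∀ a u t → a + u + t ≡ a + t + u
    exchange = solve-∀
    collect : ∀ b n e r → b * n + r + b * e ≡ b * (n + e) + r
    collect = solve-∀

  b*k≤n⇒k<n : ∀ {k n} → 0 < n → b * k ≤ n → k < n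
  b*k≤n⇒k<n {zero}  0<n _     = 0<n
  b*k≤n⇒k<n {suc k} {n} _ bk≤n = <-≤-trans (m<m*n (suc k) b (s≤s (s≤s z≤n))) (subst (_≤ n) (*-comm b (suc k)) bk≤n)

  b-digits : ∀ p → ∃₂ λ q r → r ≤ c × p ≡ b * q + r
  b-digits p with division b p
  ... | q , r , r<b , eq = q , r , ≤-pred r<b , eq

  suc-hole : ∀ n → suc (hole n) ≡ b * suc n
  suc-hole n = rearrange c n
    where
    rearrange : ∀ c n → suc (suc c * n + c) ≡ suc c * suc n
    rearrange = solve-∀

  b-digits-mono : ∀ {q q′} r r′ → q < q′ → r ≤ c → b * q + r < b * q′ + r′
  b-digits-mono {q} {q′} r r′ q<q′ r≤c = begin-strict
    b * q + r   <⟨ +-monoʳ-< (b * q) (s≤s r≤c) ⟩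
    b * q + b   ≡⟨ +-comm (b * q) b ⟩
    b + b * q   ≡⟨ *-suc b q ⟨
    b * suc q   ≤⟨ *-monoʳ-≤ b q<q′ ⟩
    b * q′      ≤⟨ m≤m+n (b * q′) r′ ⟩
    b * q′ + r′ ∎
    where open ≤-Reasoning

  b-digits-unique : ∀ {q q′ r r′} → b * q + r ≡ b * q′ + r′ → r ≤ c → r′ ≤ c → q ≡ q′ × r ≡ r′
  b-digits-unique {q} {q′} {r} {r′} eq r≤c r′≤c with <-cmp q q′
  ... | tri< q<q′ _ _ = ⊥-elim (<-irrefl eq (b-digits-mono r r′ q<q′ r≤c))
  ... | tri> _ _ q>q′ = ⊥-elim (<-irrefl (sym eq) (b-digits-mono r′ r q>q′ r′≤c))
  ... | tri≈ _ refl _ = refl , +-cancelˡ-≡ (b * q) _ _ eq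

  -- The hypothesis hole m < i + b says that hole m is the first hole at or after i.
  first-hole : ∀ m n i → hole m < i + b → i ≤ hole n → m ≤ n
  first-hole m n i hole-m< i≤hole-n = ≮⇒≥ λ n<m → <⇒≱ (+-cancelʳ-< _ _ _ (begin-strict
    hole n + b      ≡⟨ hole-suc n ⟨
    hole (suc n)    ≤⟨ hole-mono-≤ n<m ⟩
    hole m          <⟨ hole-m< ⟩
    i + b           ∎)) i≤hole-n
    where open ≤-Reasoning

  hole≡0⇒≡1 : ∀ n → x (hole n) ≡ 0 → x n ≡ 1
  hole≡0⇒≡1 n eq = trans (cong (_+ x n) (sym eq)) (hole-flips n)

  hole≡1⇒≡0 : ∀ n → x (hole n) ≡ 1 → x n ≡ 0
  hole≡1⇒≡0 n eq = +-cancelˡ-≡ 1 _ _ (trans (cong (_+ x n) (sym eq)) (hole-flips n))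

  ≡0⇒hole≡1 : ∀ n → x n ≡ 0 → x (hole n) ≡ 1
  ≡0⇒hole≡1 n eq = trans (sym (+-identityʳ _)) (trans (cong (x (hole n) +_) (sym eq)) (hole-flips n))

  hole-cong : ∀ n n′ → x n ≡ x n′ → x (hole n) ≡ x (hole n′)
  hole-cong n n′ eq = +-cancelʳ-≡ (x n) _ _ (trans (hole-flips n) (sym (trans (cong (x (hole n′) +_) eq) (hole-flips n′))))

  hole-injective : ∀ n n′ → x (hole n) ≡ x (hole n′) → x n ≡ x n′
  hole-injective n n′ eq = +-cancelˡ-≡ (x (hole n)) _ _ (trans (hole-flips n) (sym (trans (cong (_+ x n′) eq) (hole-flips n′))))

  binary : ∀ p → x p ≡ 0 ⊎ x p ≡ 1
  binary p with b-digits p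
  ... | q , r , r≤c , refl with m≤n⇒m<n∨m≡n r≤c
  ...   | inj₁ r<c = inj₂ (block-ones q r r<c)
  ...   | inj₂ refl with x (hole q) | hole-flips q
  ...     | zero  | _ = inj₁ refl
  ...     | suc zero | _ = inj₂ refl
  ...     | suc (suc _) | ()

  zero-at-hole : ∀ p → x p ≡ 0 → ∃ λ m → p ≡ hole m × x m ≡ 1
  zero-at-hole p eq with b-digits p
  ... | q , r , r≤c , refl with m≤n⇒m<n∨m≡n r≤c
  ...   | inj₁ r<c = ⊥-elim (0≢1+n (trans (sym eq) (block-ones q r r<c)))
  ...   | inj₂ refl = q , refl , hole≡0⇒≡1 q eq

  zero-isolated : ∀ n → x n ≡ 0 → x (suc n) ≡ 1
  zero-isolated n eq with zero-at-hole n eq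
  ... | m , refl , _ = trans (cong x (trans (suc-hole m) (sym (+-identityʳ _)))) (block-ones (suc m) 0 z<s)

  -- The holes of [lo, hi] pair up as hole n, hole n′ with n + n′ = m + h, and all other letters are 1:
  -- the window is the image of the palindrome x_m ⋯ x_h.
  PalindromeOn-lift : ∀ lo hi m h → lo + hi ≡ b * (m + h) + (c + c) → (∀ n → lo ≤ hole n → m ≤ n) →
    PalindromeOn x m h → PalindromeOn x lo hi
  PalindromeOn-lift lo hi m h centre first pal p q lo≤p lo≤q sum with b-digits p | b-digits q
  ... | n , r , r≤c , refl | n′ , r′ , r′≤c , refl =
    agree (m≤n⇒m<n∨m≡n r≤c) (m≤n⇒m<n∨m≡n r′≤c)
    where
    rearrange : ∀ b n n′ r r′ → b * n + r + (b * n′ + r′) ≡ b * (n + n′) + (r + r′)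
    rearrange = solve-∀
    M : ℕ
    M = m + h
    digit-sum : b * (n + n′) + (r + r′) ≡ b * M + (c + c)
    digit-sum = trans (sym (rearrange b n n′ r r′)) (trans sum centre)
    carry-free : ∀ {s} → s ≤ c → b * (n + n′) + (s + c) ≡ b * M + (c + c) → n + n′ ≡ M × s ≡ c
    carry-free {s} s≤c eq = b-digits-unique
      (+-cancelʳ-≡ c _ _ (trans (+-assoc (b * (n + n′)) s c) (trans eq (sym (+-assoc (b * M) c c))))) s≤c ≤-refl
    agree : r < c ⊎ r ≡ c → r′ < c ⊎ r′ ≡ c → x (b * n + r) ≡ x (b * n′ + r′)
    agree (inj₁ r<c)  (inj₁ r′<c) = trans (block-ones n r r<c) (sym (block-ones n′ r′ r′<c))
    agree (inj₁ r<c)  (inj₂ refl) = ⊥-elim (<⇒≢ r<c (proj₂ (carry-free r≤c digit-sum)))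
    agree (inj₂ refl) (inj₁ r′<c) = ⊥-elim (<⇒≢ r′<c (proj₂ (carry-free r′≤c
                                      (trans (cong (b * (n + n′) +_) (+-comm r′ c)) digit-sum))))
    agree (inj₂ refl) (inj₂ refl) =
      hole-cong n n′ (pal n n′ (first n lo≤p) (first n′ lo≤q) (proj₁ (carry-free ≤-refl digit-sum)))

  x0≡1 : x 0 ≡ 1
  x0≡1 = trans (cong x (sym (trans (+-identityʳ (b * 0)) (*-zeroʳ b)))) (block-ones 0 0 z<s)

  xc≡0 : x c ≡ 0
  xc≡0 = +-cancelʳ-≡ 1 _ _ (trans (cong₂ _+_ (cong x (sym hole-zero)) (sym x0≡1)) (hole-flips 0))

  private
    regroup : ∀ b P q r j → b * P * q + (b * r + j) ≡ b * (P * q + r) + j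
    regroup = solve-∀

  block-prefix : ∀ K q R → suc R < b ^ K → x (b ^ K * q + R) ≡ x R
  block-prefix zero    q R (s≤s ())
  block-prefix (suc K) q R R<b^K with b-digits R
  ... | R′ , j , j≤c , refl with m≤n⇒m<n∨m≡n j≤c
  ...   | inj₁ j<c = trans (cong x (regroup b (b ^ K) q R′ j))
                       (trans (block-ones (b ^ K * q + R′) j j<c) (sym (block-ones R′ j j<c)))
  ...   | inj₂ refl = trans (cong x (regroup b (b ^ K) q R′ c)) (hole-cong _ R′ (block-prefix K q R′ R′<b^K))
    where
    R′<b^K : suc R′ < b ^ K
    R′<b^K = *-cancelˡ-< b (suc R′) (b ^ K) (subst (_< b * b ^ K) (suc-hole R′) R<b^K)

  block-determined : ∀ K q q′ R → R < b ^ K → x q ≡ x q′ → x (b ^ K * q + R) ≡ x (b ^ K * q′ + R)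
  block-determined zero q q′ (suc R) (s≤s ())
  block-determined zero q q′ zero _ eq = subst₂ (λ p p′ → x p ≡ x p′) (unit q) (unit q′) eq
    where
    unit : ∀ q → q ≡ 1 * q + 0
    unit = solve-∀
  block-determined (suc K) q q′ R R<b^K eq with b-digits R
  ... | R′ , j , j≤c , refl with m≤n⇒m<n∨m≡n j≤c
  ...   | inj₁ j<c = trans (cong x (regroup b (b ^ K) q R′ j))
                       (trans (block-ones (b ^ K * q + R′) j j<c)
                         (sym (trans (cong x (regroup b (b ^ K) q′ R′ j)) (block-ones (b ^ K * q′ + R′) j j<c))))
  ...   | inj₂ refl = trans (cong x (regroup b (b ^ K) q R′ c))
                       (trans (hole-cong _ _ (block-determined K q q′ R′ R′<b^K eq))
                       (sym (cong x (regroup b (b ^ K) q′ R′ c))))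
    where
    R′<b^K : R′ < b ^ K
    R′<b^K = *-cancelˡ-< b R′ (b ^ K) (≤-<-trans (m≤m+n (b * R′) c) R<b^K)

  two-blocks-determined : ∀ K Q Q′ R → suc R < b ^ K + b ^ K → x Q ≡ x Q′ →
    x (b ^ K * Q + R) ≡ x (b ^ K * Q′ + R)
  two-blocks-determined K Q Q′ R R<2P eq with R <? b ^ K
  ... | yes R<P = block-determined K Q Q′ R R<P eq
  ... | no R≮P with m≤n⇒∃[o]m+o≡n (≮⇒≥ R≮P)
  ...   | R″ , refl = trans (cong x (next Q)) (trans (block-prefix K (suc Q) R″ R″<P)
                        (sym (trans (cong x (next Q′)) (block-prefix K (suc Q′) R″ R″<P))))
    where
    P : ℕ
    P = b ^ K
    next : ∀ Q → P * Q + (P + R″) ≡ P * suc Q + R″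
    next Q = rearrange P Q R″
      where
      rearrange : ∀ P Q R → P * Q + (P + R) ≡ P * suc Q + R
      rearrange = solve-∀
    R″<P : suc R″ < P
    R″<P = +-cancelˡ-< P (suc R″) P (subst (_< P + P) (sym (+-suc P R″)) R<2P)

  -- Both letters occur among x 0 and x c, so a factor of length m < b^m inside the blocks q, q + 1
  -- also occurs inside the blocks q′, q′ + 1 for some q′ ∈ {0, c}.
  factors-occur-before : ∀ m → ∃ (OccursBefore x m)
  factors-occur-before m = P * b , early
    where
    P : ℕ
    P = b ^ m
    instance P≢0 : NonZero P
    P≢0 = >-nonZero (m^n>0 b m)
    early : OccursBefore x m (P * b)
    early i with division P i
    ... | q , r , r<P , refl = P * q′ + r , bound , same
      where
      representative : ∃ λ q′ → q′ ≤ c × x q ≡ x q′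
      representative with binary q
      ... | inj₁ eq = c , ≤-refl , trans eq (sym xc≡0)
      ... | inj₂ eq = 0 , z≤n , trans eq (sym x0≡1)
      q′ : ℕ
      q′ = proj₁ representative
      bound : P * q′ + r < P * b
      bound = ≤-trans (+-monoʳ-< (P * q′) r<P)
        (≤-trans (≤-reflexive (sym (*-suc′ P q′))) (*-monoʳ-≤ P (s≤s (proj₁ (proj₂ representative)))))
        where
        *-suc′ : ∀ P q → P * suc q ≡ P * q + P
        *-suc′ = solve-∀
      reassoc : ∀ P q r k → P * q + r + k ≡ P * q + (r + k)
      reassoc = solve-∀
      same : SameFactor x (P * q + r) (P * q′ + r) m
      same k k<m = trans (cong x (reassoc P q r k))
        (trans (two-blocks-determined m q q′ (r + k) fits (proj₂ (proj₂ representative)))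
               (cong x (sym (reassoc P q′ r k))))
        where
        fits : suc (r + k) < P + P
        fits = ≤-trans (s≤s (≤-reflexive (sym (+-suc r k))))
                 (+-mono-≤ r<P (≤-trans k<m (<⇒≤ (n<[2+d]^n d m))))

module PeriodDoublingOnes {d : ℕ} {x : Word∞} (pd : PeriodDoubling d x) where

  open PeriodDoublingWord pd

  OnesOn : ℕ → ℕ → Set
  OnesOn i ℓ = ∀ k → k ≤ ℓ → x (i + k) ≡ 1

  ones-between : ∀ {i ℓ} → OnesOn i ℓ → ∀ p → i ≤ p → p ≤ i + ℓ → x p ≡ 1
  ones-between {i} {ℓ} ones p i≤p p≤i+ℓ with m≤n⇒∃[o]m+o≡n i≤p
  ... | k , refl = ones k (+-cancelˡ-≤ i k ℓ p≤i+ℓ)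

  ones-return-overlapping : ∀ i j ℓ → OnesOn i ℓ → SameFactor x i j (suc ℓ) → j ≤ suc (i + ℓ) →
    PalindromeOn x i (j + ℓ)
  ones-return-overlapping i j ℓ ones same j≤ = PalindromeOn-constant x i (j + ℓ) 1 all-ones
    where
    all-ones : ∀ p → i ≤ p → p ≤ j + ℓ → x p ≡ 1
    all-ones p i≤p p≤ with p ≤? i + ℓ
    ... | yes p≤i+ℓ = ones-between ones p i≤p p≤i+ℓ
    ... | no p≰i+ℓ with m≤n⇒∃[o]m+o≡n (≤-trans j≤ (≰⇒> p≰i+ℓ))
    ...   | k , refl = let k≤ℓ = +-cancelˡ-≤ j k ℓ p≤ in trans (sym (same k (s≤s k≤ℓ))) (ones k k≤ℓ)

  ones-followed-by-zero : ∀ i ℓ → OnesOn i ℓ → ¬ SameFactor x i (suc i) (suc ℓ) → x (suc (i + ℓ)) ≡ 0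
  ones-followed-by-zero i ℓ ones ¬same with binary (suc (i + ℓ))
  ... | inj₁ eq = eq
  ... | inj₂ eq = ⊥-elim (¬same λ k k< → trans (ones k (≤-pred k<)) (sym (shifted k (≤-pred k<))))
    where
    shifted : ∀ k → k ≤ ℓ → x (suc i + k) ≡ 1
    shifted k k≤ℓ with m≤n⇒m<n∨m≡n k≤ℓ
    ... | inj₁ k<ℓ = trans (cong x (sym (+-suc i k))) (ones (suc k) k<ℓ)
    ... | inj₂ refl = eq

  ones-preceded-by-zero : ∀ i j ℓ → OnesOn i ℓ → SameFactor x i (suc j) (suc ℓ) → ¬ SameFactor x i j (suc ℓ) →
    x j ≡ 0
  ones-preceded-by-zero i j ℓ ones same ¬same with binary j
  ... | inj₁ eq = eq
  ... | inj₂ eq = ⊥-elim (¬same shifted)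
    where
    shifted : SameFactor x i j (suc ℓ)
    shifted zero    _         = trans (ones 0 z≤n) (sym (trans (cong x (+-identityʳ j)) eq))
    shifted (suc k) (s≤s k<ℓ) = trans (ones (suc k) k<ℓ) (sym (trans (cong x (+-suc j k))
                                  (trans (sym (same k (m≤n⇒m≤1+n k<ℓ))) (ones k (<⇒≤ k<ℓ)))))

  module OnesThenZero (i j ℓ : ℕ) (ones : OnesOn i ℓ) (far : suc (i + ℓ) < j)
                      (none : NoOccurrenceBetween x i j (suc ℓ)) where

    e : ℕ
    e = suc (i + ℓ)

    x-e≡0 : x e ≡ 0
    x-e≡0 = ones-followed-by-zero i ℓ ones (none (suc i) ≤-refl (≤-trans (s≤s (s≤s (m≤m+n i ℓ))) far))

    m : ℕ
    m = proj₁ (zero-at-hole e x-e≡0)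

    e≡hole-m : e ≡ hole m
    e≡hole-m = proj₁ (proj₂ (zero-at-hole e x-e≡0))

  short-ones-return : ∀ i j ℓ → ℓ < c → OnesOn i ℓ → SameFactor x i j (suc ℓ) →
    NoOccurrenceBetween x i j (suc ℓ) → PalindromeOn x i (j + ℓ)
  short-ones-return i j ℓ ℓ<c ones same none with j ≤? suc (i + ℓ)
  ... | yes j≤ = ones-return-overlapping i j ℓ ones same j≤
  ... | no j≰ = PalindromeOn-lift i (j + ℓ) m m centre (λ n → first-hole m n i hole-m<i+b) (PalindromeOn-letter x m)
    where
    open OnesThenZero i j ℓ ones (≰⇒> j≰) none
    -- the block following the hole e begins with c > ℓ ones
    returns-after-zero : SameFactor x i (suc e) (suc ℓ)
    returns-after-zero k k≤ℓ = trans (ones k (≤-pred k≤ℓ)) (sym (trans (cong (λ z → x (z + k)) (trans (cong suc e≡hole-m) (suc-hole m)))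
                                 (block-ones (suc m) k (≤-trans k≤ℓ ℓ<c))))
    j≡ : j ≡ suc e
    j≡ = ≤-antisym (≮⇒≥ λ 1+e<j → none (suc e) (s≤s (≤-trans (m≤m+n i ℓ) (n≤1+n _))) 1+e<j returns-after-zero) (≰⇒> j≰)
    rearrange : ∀ i ℓ e → i + (suc e + ℓ) ≡ suc (i + ℓ) + e
    rearrange = solve-∀
    double : ∀ b m c → b * m + c + (b * m + c) ≡ b * (m + m) + (c + c)
    double = solve-∀
    centre : i + (j + ℓ) ≡ b * (m + m) + (c + c)
    centre = trans (cong (λ z → i + (z + ℓ)) j≡) (trans (rearrange i ℓ e) (trans (cong₂ _+_ e≡hole-m e≡hole-m) (double b m c)))
    hole-m<i+b : hole m < i + b
    hole-m<i+b = begin-strict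
      hole m          ≡⟨ e≡hole-m ⟨
      suc (i + ℓ)     ≡⟨ +-suc i ℓ ⟨
      i + suc ℓ       <⟨ +-monoʳ-< i (s≤s ℓ<c) ⟩
      i + b           ∎
      where open ≤-Reasoning

  zero-letter-first-hole : ∀ i ℓ n → OnesOn i ℓ → x n ≡ 0 → hole n ≤ i + ℓ → hole n < i + b
  zero-letter-first-hole i ℓ zero    ones _ _ = ≤-trans (s≤s (≤-reflexive hole-zero)) (m≤n+m b i)
  zero-letter-first-hole i ℓ (suc n) ones x-n≡0 hole≤ with i ≤? hole n
  ... | yes i≤hole-n = ⊥-elim (0≢1+n (trans (sym x-n≡0) (zero-isolated n
                         (hole≡1⇒≡0 n (ones-between ones (hole n) i≤hole-n
                           (≤-trans (<⇒≤ (b-digits-mono c c (n<1+n n) ≤-refl)) hole≤))))))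
  ... | no i≰hole-n = subst (_< i + b) (sym (hole-suc n)) (+-monoˡ-< b (≰⇒> i≰hole-n))

  -- The last hole in the first occurrence and the first hole in the second are holes n₁ < n₂ with
  -- x n₁ = x n₂ = 0 and only ones in between, so the return is the image of the palindrome x_{n₁} ⋯ x_{n₂}.
  module LongOnesReturn (i j′ ℓ : ℕ) (c≤ℓ : c ≤ ℓ) (ones : OnesOn i ℓ) (same : SameFactor x i (suc j′) (suc ℓ))
                        (none : NoOccurrenceBetween x i (suc j′) (suc ℓ)) (far : suc (i + ℓ) < suc j′) where

    open OnesThenZero i (suc j′) ℓ ones far none

    c<e : c < e
    c<e = s≤s (≤-trans c≤ℓ (m≤n+m ℓ i))

    0<m : 0 < m
    0<m = n≢0⇒n>0 λ m≡0 → <⇒≢ c<e (sym (trans e≡hole-m (trans (cong hole m≡0) hole-zero)))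

    n₁ : ℕ
    n₁ = pred m

    e≡hole-n₁+b : e ≡ hole n₁ + b
    e≡hole-n₁+b = trans e≡hole-m (trans (cong hole (sym (suc-pred m {{>-nonZero 0<m}}))) (hole-suc n₁))

    i≤hole-n₁ : i ≤ hole n₁
    i≤hole-n₁ = +-cancelʳ-≤ b i (hole n₁) (begin
      i + b           ≤⟨ +-monoʳ-≤ i (s≤s c≤ℓ) ⟩
      i + suc ℓ       ≡⟨ +-suc i ℓ ⟩
      e               ≡⟨ e≡hole-n₁+b ⟩
      hole n₁ + b     ∎)
      where open ≤-Reasoning

    hole-n₁≤ : hole n₁ ≤ i + ℓ
    hole-n₁≤ = ≤-pred (subst (hole n₁ <_) (sym e≡hole-n₁+b) (m<m+n (hole n₁) z<s))

    x-n₁≡0 : x n₁ ≡ 0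
    x-n₁≡0 = hole≡1⇒≡0 n₁ (ones-between ones (hole n₁) i≤hole-n₁ hole-n₁≤)

    hole-n₁<i+b : hole n₁ < i + b
    hole-n₁<i+b = zero-letter-first-hole i ℓ n₁ ones x-n₁≡0 hole-n₁≤

    ℓ<b+c : ℓ < b + c
    ℓ<b+c = s<s⁻¹ (+-cancelˡ-< i (suc ℓ) (suc (b + c)) (begin-strict
      i + suc ℓ          ≡⟨ +-suc i ℓ ⟩
      e                  ≡⟨ e≡hole-n₁+b ⟩
      hole n₁ + b        <⟨ +-monoˡ-< b hole-n₁<i+b ⟩
      i + b + b          ≡⟨ rearrange i c ⟩
      i + suc (b + c)    ∎))
      where
      open ≤-Reasoning
      rearrange : ∀ i c → i + suc c + suc c ≡ i + suc (suc c + c)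
      rearrange = solve-∀

    i<j′ : i < j′
    i<j′ = ≤-trans (s≤s (m≤m+n i ℓ)) (s≤s⁻¹ far)

    x-j′≡0 : x j′ ≡ 0
    x-j′≡0 = ones-preceded-by-zero i j′ ℓ ones same (none j′ i<j′ ≤-refl)

    m₂ : ℕ
    m₂ = proj₁ (zero-at-hole j′ x-j′≡0)

    j′≡hole-m₂ : j′ ≡ hole m₂
    j′≡hole-m₂ = proj₁ (proj₂ (zero-at-hole j′ x-j′≡0))

    n₂ : ℕ
    n₂ = suc m₂

    hole-n₂≡ : hole n₂ ≡ suc j′ + c
    hole-n₂≡ = trans (hole-suc m₂) (trans (cong (_+ b) (sym j′≡hole-m₂)) (+-suc j′ c))

    x-n₂≡0 : x n₂ ≡ 0
    x-n₂≡0 = hole≡1⇒≡0 n₂ (trans (cong x hole-n₂≡) (trans (sym (same c (s≤s c≤ℓ))) (ones c c≤ℓ)))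

    -- Otherwise the block of ones would already occur at b n, strictly between i and j′ + 1.
    ones-between-holes : ∀ n → n₁ < n → n < n₂ → x n ≡ 1
    ones-between-holes n n₁<n n<n₂ with binary n
    ... | inj₂ x-n≡1 = x-n≡1
    ... | inj₁ x-n≡0 = ⊥-elim (none (b * n) i<b*n b*n<j (λ k k≤ℓ → trans (ones k (≤-pred k≤ℓ)) (sym (ones-at-b*n k (≤-pred k≤ℓ)))))
      where
      ones-at-b*n : ∀ k → k ≤ ℓ → x (b * n + k) ≡ 1
      ones-at-b*n k k≤ℓ with k ≤? c
      ... | yes k≤c = [ block-ones n k , (λ { refl → ≡0⇒hole≡1 n x-n≡0 }) ]′ (m≤n⇒m<n∨m≡n k≤c)
      ... | no k≰c with m≤n⇒∃[o]m+o≡n (≰⇒> k≰c)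
      ...   | k″ , refl = trans (cong x (next-block b n k″))
                            (block-ones (suc n) k″ (+-cancelˡ-< b k″ c (≤-<-trans k≤ℓ ℓ<b+c)))
        where
        next-block : ∀ b n k → b * n + (b + k) ≡ b * suc n + k
        next-block = solve-∀
      i<b*n : i < b * n
      i<b*n = ≤-<-trans i≤hole-n₁ (subst (hole n₁ <_) (+-identityʳ (b * n)) (b-digits-mono c 0 n₁<n ≤-refl))
      b*n<j : b * n < suc j′
      b*n<j = s≤s (≤-trans (*-monoʳ-≤ b (s≤s⁻¹ n<n₂)) (subst (b * m₂ ≤_) (sym j′≡hole-m₂) (m≤m+n (b * m₂) c)))

    centre : i + (suc j′ + ℓ) ≡ b * (n₁ + n₂) + (c + c)
    centre = begin
      i + (suc j′ + ℓ)                ≡⟨ rearrange i ℓ j′ ⟩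
      e + j′                          ≡⟨ cong₂ _+_ e≡hole-n₁+b j′≡hole-m₂ ⟩
      b * n₁ + c + b + (b * m₂ + c)   ≡⟨ collect b n₁ m₂ c ⟩
      b * (n₁ + n₂) + (c + c)         ∎
      where
      open ≡-Reasoning
      rearrange : ∀ i ℓ j → i + (suc j + ℓ) ≡ suc (i + ℓ) + j
      rearrange = solve-∀
      collect : ∀ b n₁ m₂ c → b * n₁ + c + b + (b * m₂ + c) ≡ b * (n₁ + suc m₂) + (c + c)
      collect = solve-∀

    palindrome : PalindromeOn x i (suc j′ + ℓ)
    palindrome = PalindromeOn-lift i (suc j′ + ℓ) n₁ n₂ centre (λ n → first-hole n₁ n i hole-n₁<i+b)
                   (PalindromeOn-framed x n₁ n₂ 1 (trans x-n₁≡0 (sym x-n₂≡0)) ones-between-holes)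

  long-ones-return : ∀ i j ℓ → c ≤ ℓ → OnesOn i ℓ → SameFactor x i j (suc ℓ) →
    NoOccurrenceBetween x i j (suc ℓ) → PalindromeOn x i (j + ℓ)
  long-ones-return i j ℓ c≤ℓ ones same none with j ≤? suc (i + ℓ)
  ... | yes j≤ = ones-return-overlapping i j ℓ ones same j≤
  long-ones-return i zero     ℓ c≤ℓ ones same none | no j≰ = ⊥-elim (j≰ z≤n)
  long-ones-return i (suc j′) ℓ c≤ℓ ones same none | no j≰ =
    LongOnesReturn.palindrome i j′ ℓ c≤ℓ ones same none (≰⇒> j≰)

module PeriodDoublingZeros {d : ℕ} {x : Word∞} (pd : PeriodDoubling d x) where

  open PeriodDoublingWord pd

  -- A palindrome x_i ⋯ x_{i+ℓ} containing a zero is the image of the shorter palindrome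
  -- x_lo ⋯ x_{lo+ℓ′}, where hole lo and hole hi are its first and last holes.
  module PalindromeWithZero (i ℓ p₀ : ℕ) (p₀≤ℓ : p₀ ≤ ℓ) (x-p₀≡0 : x (i + p₀) ≡ 0)
                            (pal : PalindromeOn x i (i + ℓ)) where

    mirror-sum : i + p₀ + (i + (ℓ ∸ p₀)) ≡ i + (i + ℓ)
    mirror-sum = trans (rearrange i p₀ (ℓ ∸ p₀)) (cong (λ z → i + (i + z)) (m+[n∸m]≡n p₀≤ℓ))
      where
      rearrange : ∀ i p u → i + p + (i + u) ≡ i + (i + (p + u))
      rearrange = solve-∀

    x-mirror≡0 : x (i + (ℓ ∸ p₀)) ≡ 0
    x-mirror≡0 = trans (sym (pal _ _ (m≤m+n i p₀) (m≤m+n i _) mirror-sum)) x-p₀≡0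

    n₀ n₀′ : ℕ
    n₀  = proj₁ (zero-at-hole _ x-p₀≡0)
    n₀′ = proj₁ (zero-at-hole _ x-mirror≡0)

    i+p₀≡hole-n₀ : i + p₀ ≡ hole n₀
    i+p₀≡hole-n₀ = proj₁ (proj₂ (zero-at-hole _ x-p₀≡0))

    mirror≡hole-n₀′ : i + (ℓ ∸ p₀) ≡ hole n₀′
    mirror≡hole-n₀′ = proj₁ (proj₂ (zero-at-hole _ x-mirror≡0))

    M₀ : ℕ
    M₀ = n₀ + n₀′

    holes-sum : ∀ n n′ → hole n + hole n′ ≡ b * (n + n′) + (c + c)
    holes-sum n n′ = collect b n n′ c
      where
      collect : ∀ b n n′ c → b * n + c + (b * n′ + c) ≡ b * (n + n′) + (c + c)
      collect = solve-∀

    centre : b * M₀ + (c + c) ≡ i + (i + ℓ)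
    centre = trans (sym (holes-sum n₀ n₀′)) (trans (cong₂ _+_ (sym i+p₀≡hole-n₀) (sym mirror≡hole-n₀′)) mirror-sum)

    holes-pair : ∀ n n′ → n + n′ ≡ M₀ → hole n + hole n′ ≡ i + (i + ℓ)
    holes-pair n n′ sum = trans (holes-sum n n′) (trans (cong (λ z → b * z + (c + c)) sum) centre)

    first : ∃ λ n → n ≤ n₀ × i ≤ hole n × (∀ k → k < n → ¬ i ≤ hole k)
    first = least (λ n → i ≤? hole n) n₀ (subst (i ≤_) i+p₀≡hole-n₀ (m≤m+n i p₀))

    lo : ℕ
    lo = proj₁ first

    i≤hole-lo : i ≤ hole lo
    i≤hole-lo = proj₁ (proj₂ (proj₂ first))

    lo-least : ∀ n → i ≤ hole n → lo ≤ n
    lo-least n i≤hole-n = ≮⇒≥ λ n<lo → proj₂ (proj₂ (proj₂ first)) n n<lo i≤hole-n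

    i≤hole : ∀ n → lo ≤ n → i ≤ hole n
    i≤hole n lo≤n = ≤-trans i≤hole-lo (hole-mono-≤ lo≤n)

    lo≤n₀ : lo ≤ n₀
    lo≤n₀ = proj₁ (proj₂ first)

    lo≤n₀′ : lo ≤ n₀′
    lo≤n₀′ = lo-least n₀′ (subst (i ≤_) mirror≡hole-n₀′ (m≤m+n i _))

    hi : ℕ
    hi = M₀ ∸ lo

    lo+hi≡M₀ : lo + hi ≡ M₀
    lo+hi≡M₀ = m+[n∸m]≡n (≤-trans lo≤n₀ (m≤m+n n₀ n₀′))

    lo≤hi : lo ≤ hi
    lo≤hi = +-cancelˡ-≤ lo lo hi (≤-trans (+-mono-≤ lo≤n₀ lo≤n₀′) (≤-reflexive (sym lo+hi≡M₀)))

    hole-hi≤ : hole hi ≤ i + ℓ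
    hole-hi≤ = mirror-≤ (trans (+-comm (hole hi) (hole lo)) (holes-pair lo hi lo+hi≡M₀)) i≤hole-lo

    hole≤ : ∀ n → n ≤ hi → hole n ≤ i + ℓ
    hole≤ n n≤hi = ≤-trans (hole-mono-≤ n≤hi) hole-hi≤

    hi-greatest : ∀ n → hole n ≤ i + ℓ → n ≤ hi
    hi-greatest n hole-n≤ with n ≤? M₀
    ... | yes n≤M₀ = +-cancelˡ-≤ lo n hi (begin
      lo + n           ≡⟨ +-comm lo n ⟩
      n + lo           ≤⟨ +-monoʳ-≤ n (lo-least (M₀ ∸ n) (mirror-≤ (sym (holes-pair n (M₀ ∸ n) (m+[n∸m]≡n n≤M₀))) hole-n≤)) ⟩
      n + (M₀ ∸ n)     ≡⟨ m+[n∸m]≡n n≤M₀ ⟩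
      M₀               ≡⟨ lo+hi≡M₀ ⟨
      lo + hi          ∎)
      where open ≤-Reasoning
    ... | no n≰M₀ = ⊥-elim (<⇒≱ (begin-strict
      i + ℓ            ≤⟨ m≤n+m (i + ℓ) i ⟩
      i + (i + ℓ)      ≡⟨ centre ⟨
      b * M₀ + (c + c) <⟨ n<1+n _ ⟩
      _                ≡⟨ one-more b M₀ c ⟨
      hole M₀ + b      ≡⟨ hole-suc M₀ ⟨
      hole (suc M₀)    ≤⟨ hole-mono-≤ (≰⇒> n≰M₀) ⟩
      hole n           ∎) hole-n≤)
      where
      open ≤-Reasoning
      one-more : ∀ b M c → b * M + c + suc c ≡ suc (b * M + (c + c))
      one-more = solve-∀

    ℓ′ : ℕ
    ℓ′ = hi ∸ lo

    lo+ℓ′≡hi : lo + ℓ′ ≡ hi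
    lo+ℓ′≡hi = m+[n∸m]≡n lo≤hi

    desubstituted : PalindromeOn x lo (lo + ℓ′)
    desubstituted p q lo≤p lo≤q sum = hole-injective p q (pal (hole p) (hole q) (i≤hole p lo≤p) (i≤hole q lo≤q)
      (holes-pair p q (trans sum (trans (cong (lo +_) lo+ℓ′≡hi) lo+hi≡M₀))))

    b*ℓ′≤ℓ : b * ℓ′ ≤ ℓ
    b*ℓ′≤ℓ = +-cancelˡ-≤ (hole lo) _ _ (begin
      hole lo + b * ℓ′  ≡⟨ hole-+ lo ℓ′ ⟨
      hole (lo + ℓ′)    ≡⟨ cong hole lo+ℓ′≡hi ⟩
      hole hi           ≤⟨ hole-hi≤ ⟩
      i + ℓ             ≤⟨ +-monoˡ-≤ ℓ i≤hole-lo ⟩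
      hole lo + ℓ       ∎)
      where open ≤-Reasoning

    module Return (j : ℕ) (i<j : i < j) (same : SameFactor x i j (suc ℓ))
                  (none : NoOccurrenceBetween x i j (suc ℓ)) where

      x-j+p₀≡0 : x (j + p₀) ≡ 0
      x-j+p₀≡0 = trans (sym (same p₀ (s≤s p₀≤ℓ))) x-p₀≡0

      nⱼ : ℕ
      nⱼ = proj₁ (zero-at-hole _ x-j+p₀≡0)

      j+p₀≡hole-nⱼ : j + p₀ ≡ hole nⱼ
      j+p₀≡hole-nⱼ = proj₁ (proj₂ (zero-at-hole _ x-j+p₀≡0))

      j+b*n₀≡i+b*nⱼ : j + b * n₀ ≡ i + b * nⱼ
      j+b*n₀≡i+b*nⱼ = +-cancelʳ-≡ (p₀ + c) _ _ (begin
        j + b * n₀ + (p₀ + c)      ≡⟨ exchange j p₀ b n₀ c ⟨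
        j + p₀ + (b * n₀ + c)      ≡⟨ cong₂ _+_ j+p₀≡hole-nⱼ (sym i+p₀≡hole-n₀) ⟩
        b * nⱼ + c + (i + p₀)      ≡⟨ exchange′ b nⱼ c i p₀ ⟩
        i + b * nⱼ + (p₀ + c)      ∎)
        where
        open ≡-Reasoning
        exchange : ∀ j p b n c → j + p + (b * n + c) ≡ j + b * n + (p + c)
        exchange = solve-∀
        exchange′ : ∀ b n c i p → b * n + c + (i + p) ≡ i + b * n + (p + c)
        exchange′ = solve-∀

      n₀<nⱼ : n₀ < nⱼ
      n₀<nⱼ = ≰⇒> λ nⱼ≤n₀ → <-irrefl (sym j+b*n₀≡i+b*nⱼ) (+-mono-<-≤ i<j (*-monoʳ-≤ b nⱼ≤n₀))

      δ : ℕ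
      δ = nⱼ ∸ n₀

      n₀+δ≡nⱼ : n₀ + δ ≡ nⱼ
      n₀+δ≡nⱼ = m+[n∸m]≡n (<⇒≤ n₀<nⱼ)

      0<δ : 0 < δ
      0<δ = +-cancelˡ-< n₀ 0 δ (subst₂ _<_ (sym (+-identityʳ n₀)) (sym n₀+δ≡nⱼ) n₀<nⱼ)

      j≡i+b*δ : j ≡ i + b * δ
      j≡i+b*δ = +-cancelʳ-≡ (b * n₀) _ _ (trans j+b*n₀≡i+b*nⱼ
                  (trans (cong (λ z → i + b * z) (sym n₀+δ≡nⱼ)) (expand i b n₀ δ)))
        where
        expand : ∀ i b n δ → i + b * (n + δ) ≡ i + b * δ + b * n
        expand = solve-∀

      lift-occurrence : ∀ e → SameFactor x lo (lo + e) (suc ℓ′) → SameFactor x i (i + b * e) (suc ℓ)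
      lift-occurrence e same′ t t≤ℓ with b-digits (i + t)
      ... | n , r , r≤c , i+t≡ with m≤n⇒m<n∨m≡n r≤c
      ...   | inj₁ r<c = trans (cong x i+t≡) (trans (block-ones n r r<c)
                           (sym (trans (cong x (shift-blocks i e t n r i+t≡)) (block-ones (n + e) r r<c))))
      ...   | inj₂ refl = trans (cong x i+t≡) (trans (hole-cong n (n + e) x-n≡x-n+e)
                            (cong x (sym (shift-blocks i e t n c i+t≡))))
        where
        lo≤n : lo ≤ n
        lo≤n = lo-least n (subst (i ≤_) i+t≡ (m≤m+n i t))
        k : ℕ
        k = n ∸ lo
        lo+k≡n : lo + k ≡ n
        lo+k≡n = m+[n∸m]≡n lo≤n
        k≤ℓ′ : k ≤ ℓ′
        k≤ℓ′ = +-cancelˡ-≤ lo k ℓ′ (subst₂ _≤_ (sym lo+k≡n) (sym lo+ℓ′≡hi)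
                 (hi-greatest n (subst (_≤ i + ℓ) i+t≡ (+-monoʳ-≤ i (s≤s⁻¹ t≤ℓ)))))
        x-n≡x-n+e : x n ≡ x (n + e)
        x-n≡x-n+e = trans (cong x (sym lo+k≡n)) (trans (same′ k (s≤s k≤ℓ′))
                      (cong x (trans (exchange lo e k) (cong (_+ e) lo+k≡n))))
          where
          exchange : ∀ a e k → a + e + k ≡ a + k + e
          exchange = solve-∀

      desubstituted-return : SameFactor x lo (lo + δ) (suc ℓ′)
      desubstituted-return k k≤ℓ′ = trans (hole-injective n (n + δ) (begin
          x (hole n)          ≡⟨ cong x i+t≡hole-n ⟨
          x (i + t)           ≡⟨ same t (s≤s t≤ℓ) ⟩
          x (j + t)           ≡⟨ cong (λ z → x (z + t)) j≡i+b*δ ⟩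
          x (i + b * δ + t)   ≡⟨ cong x (shift-blocks i δ t n c i+t≡hole-n) ⟩
          x (hole (n + δ))    ∎))
        (cong x (exchange lo k δ))
        where
        open ≡-Reasoning
        n : ℕ
        n = lo + k
        t : ℕ
        t = hole n ∸ i
        i+t≡hole-n : i + t ≡ hole n
        i+t≡hole-n = m+[n∸m]≡n (i≤hole n (m≤m+n lo k))
        t≤ℓ : t ≤ ℓ
        t≤ℓ = +-cancelˡ-≤ i t ℓ (subst (_≤ i + ℓ) (sym i+t≡hole-n)
                (hole≤ n (subst (n ≤_) lo+ℓ′≡hi (+-monoʳ-≤ lo (s≤s⁻¹ k≤ℓ′)))))
        exchange : ∀ a k e → a + k + e ≡ a + e + k
        exchange = solve-∀

      desubstituted-none : NoOccurrenceBetween x lo (lo + δ) (suc ℓ′)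
      desubstituted-none k lo<k k<lo+δ same′ with m≤n⇒∃[o]m+o≡n (<⇒≤ lo<k)
      ... | e , refl = none (i + b * e) (m<m+n i (subst (_< b * e) (*-zeroʳ b) (*-monoʳ-< b 0<e)))
                         (subst (i + b * e <_) (sym j≡i+b*δ) (+-monoʳ-< i (*-monoʳ-< b (+-cancelˡ-< lo e δ k<lo+δ))))
                         (lift-occurrence e same′)
        where
        0<e : 0 < e
        0<e = +-cancelˡ-< lo 0 e (subst (_< lo + e) (sym (+-identityʳ lo)) lo<k)

      lift-return : PalindromeOn x lo (lo + δ + ℓ′) → PalindromeOn x i (j + ℓ)
      lift-return = PalindromeOn-lift i (j + ℓ) lo (lo + δ + ℓ′) centre′ lo-least
        where
        open ≡-Reasoning
        centre′ : i + (j + ℓ) ≡ b * (lo + (lo + δ + ℓ′)) + (c + c)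
        centre′ = begin
          i + (j + ℓ)                        ≡⟨ cong (λ z → i + (z + ℓ)) j≡i+b*δ ⟩
          i + (i + b * δ + ℓ)                ≡⟨ exchange i (b * δ) ℓ ⟩
          i + (i + ℓ) + b * δ                ≡⟨ cong (_+ b * δ) centre ⟨
          b * M₀ + (c + c) + b * δ           ≡⟨ collect b M₀ δ c ⟩
          b * (M₀ + δ) + (c + c)             ≡⟨ cong (λ z → b * (z + δ) + (c + c)) (sym lo+hi≡M₀) ⟩
          b * (lo + hi + δ) + (c + c)        ≡⟨ cong (λ z → b * (lo + z + δ) + (c + c)) (sym lo+ℓ′≡hi) ⟩
          b * (lo + (lo + ℓ′) + δ) + (c + c) ≡⟨ cong (λ z → b * z + (c + c)) (reorder lo ℓ′ δ) ⟩
          b * (lo + (lo + δ + ℓ′)) + (c + c) ∎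
          where
          exchange : ∀ i u ℓ → i + (i + u + ℓ) ≡ i + (i + ℓ) + u
          exchange = solve-∀
          collect : ∀ b M δ c → b * M + (c + c) + b * δ ≡ b * (M + δ) + (c + c)
          collect = solve-∀
          reorder : ∀ a ℓ δ → a + (a + ℓ) + δ ≡ a + (a + δ + ℓ)
          reorder = solve-∀

module PeriodDoublingRichness {d : ℕ} {x : Word∞} (pd : PeriodDoubling d x) where

  open PeriodDoublingWord pd
  open PeriodDoublingOnes pd
  open PeriodDoublingZeros pd

  ReturnsPalindromic : ℕ → Set
  ReturnsPalindromic ℓ = ∀ i j → i < j → SameFactor x i j (suc ℓ) → PalindromeOn x i (i + ℓ) →
    NoOccurrenceBetween x i j (suc ℓ) → PalindromeOn x i (j + ℓ)

  zero-return : ∀ i j → x i ≡ 0 → SameFactor x i j 1 → NoOccurrenceBetween x i j 1 → PalindromeOn x i (j + 0)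
  zero-return i j x-i≡0 same none = PalindromeOn-framed x i (j + 0) 1 ends inner
    where
    ends : x i ≡ x (j + 0)
    ends = trans (cong x (sym (+-identityʳ i))) (same 0 z<s)
    inner : ∀ p → i < p → p < j + 0 → x p ≡ 1
    inner p i<p p<j with binary p
    ... | inj₂ x-p≡1 = x-p≡1
    ... | inj₁ x-p≡0 = ⊥-elim (none p i<p (subst (p <_) (+-identityʳ j) p<j)
                         λ { zero _ → subst₂ (λ u v → x u ≡ x v) (sym (+-identityʳ i)) (sym (+-identityʳ p))
                                        (trans x-i≡0 (sym x-p≡0))
                           ; (suc _) (s≤s ()) })

  ones-or-zero : ∀ i ℓ → OnesOn i ℓ ⊎ ∃ λ p₀ → p₀ ≤ ℓ × x (i + p₀) ≡ 0
  ones-or-zero i ℓ with anyUpTo? (λ k → x (i + k) ≟ 0) (suc ℓ)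
  ... | yes (p₀ , p₀<1+ℓ , x≡0) = inj₂ (p₀ , s≤s⁻¹ p₀<1+ℓ , x≡0)
  ... | no ¬zero = inj₁ λ k k≤ℓ → [ (λ x≡0 → ⊥-elim (¬zero (k , s≤s k≤ℓ , x≡0))) , id ]′ (binary (i + k))

  -- For ℓ = 0 desubstitution does not shorten the palindrome, but a complete return to 0 is 0 1⋯1 0.
  zero-containing-return : ∀ ℓ → (∀ {ℓ′} → ℓ′ < ℓ → ReturnsPalindromic ℓ′) → ∀ i j p₀ → p₀ ≤ ℓ → x (i + p₀) ≡ 0 →
    i < j → SameFactor x i j (suc ℓ) → PalindromeOn x i (i + ℓ) → NoOccurrenceBetween x i j (suc ℓ) →
    PalindromeOn x i (j + ℓ)
  zero-containing-return zero    _  i j zero p₀≤ℓ x≡0 _   same _   none =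
    zero-return i j (trans (cong x (sym (+-identityʳ i))) x≡0) same none
  zero-containing-return (suc ℓ) ih i j p₀ p₀≤ℓ x≡0 i<j same pal none =
    lift-return (ih (b*k≤n⇒k<n z<s b*ℓ′≤ℓ) lo (lo + δ) (m<m+n lo 0<δ) desubstituted-return desubstituted desubstituted-none)
    where
    open PalindromeWithZero i (suc ℓ) p₀ p₀≤ℓ x≡0 pal
    open Return j i<j same none

  returns-palindromic : ∀ ℓ → ReturnsPalindromic ℓ
  returns-palindromic = <-rec ReturnsPalindromic step
    where
    step : ∀ ℓ → (∀ {ℓ′} → ℓ′ < ℓ → ReturnsPalindromic ℓ′) → ReturnsPalindromic ℓ
    step ℓ ih i j i<j same pal none with ones-or-zero i ℓ | ℓ <? c
    ... | inj₁ ones               | yes ℓ<c = short-ones-return i j ℓ ℓ<c ones same none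
    ... | inj₁ ones               | no ℓ≮c  = long-ones-return i j ℓ (≮⇒≥ ℓ≮c) ones same none
    ... | inj₂ (p₀ , p₀≤ℓ , x≡0) | _        = zero-containing-return ℓ ih i j p₀ p₀≤ℓ x≡0 i<j same pal none

  complete-returns-palindromic : CompleteReturnsPalindromic x
  complete-returns-palindromic i j ℓ = returns-palindromic ℓ i j

-- Digit sums and the word S(t_{b,2})

[1+m]%2+m%2≡1 : ∀ m → suc m % 2 + m % 2 ≡ 1
[1+m]%2+m%2≡1 zero          = refl
[1+m]%2+m%2≡1 (suc zero)    = refl
[1+m]%2+m%2≡1 (suc (suc m)) = [1+m]%2+m%2≡1 m

module BaseDigits (d : ℕ) where

  B : ℕ
  B = suc (suc d)

  s : ℕ → ℕ
  s = digitSum B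

  t : Word∞
  t = tb2 B

  digitSumFuel-0 : ∀ f → digitSumFuel B f 0 ≡ 0
  digitSumFuel-0 zero    = refl
  digitSumFuel-0 (suc f) = digitSumFuel-0 f

  digitSumFuel-enough : ∀ f g n → n ≤ f → n ≤ g → digitSumFuel B f n ≡ digitSumFuel B g n
  digitSumFuel-enough zero    g       n n≤0 _   rewrite n≤0⇒n≡0 n≤0 = sym (digitSumFuel-0 g)
  digitSumFuel-enough (suc f) zero    n _   n≤0 rewrite n≤0⇒n≡0 n≤0 = digitSumFuel-0 (suc f)
  digitSumFuel-enough (suc f) (suc g) n n≤f n≤g =
    cong (n % B +_) (digitSumFuel-enough f g (n / B) (quotient-fuel n f n≤f) (quotient-fuel n g n≤g))
    where
    quotient-fuel : ∀ n f → n ≤ suc f → n / B ≤ f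
    quotient-fuel zero    f _   = z≤n
    quotient-fuel (suc n) f n≤f = ≤-pred (≤-trans (m/n<m (suc n) B (s≤s (s≤s z≤n))) n≤f)

  [B*n+j]%B≡j : ∀ n j → j < B → (B * n + j) % B ≡ j
  [B*n+j]%B≡j n j j<B = trans (cong (_% B) (trans (+-comm (B * n) j) (cong (j +_) (*-comm B n))))
                          (trans ([m+kn]%n≡m%n j n B) (m<n⇒m%n≡m j<B))

  [B*n+j]/B≡n : ∀ n j → j < B → (B * n + j) / B ≡ n
  [B*n+j]/B≡n n j j<B = begin
    (B * n + j) / B            ≡⟨ /-congˡ (trans (+-comm (B * n) j) (cong (j +_) (*-comm B n))) ⟩
    (j + n * B) / B            ≡⟨ +-distrib-/ j (n * B) no-carry ⟩
    j / B + n * B / B          ≡⟨ cong₂ _+_ (m<n⇒m/n≡0 j<B) (m*n/n≡m n B) ⟩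
    n                          ∎
    where
    open ≡-Reasoning
    no-carry : j % B + n * B % B < B
    no-carry = subst (_< B) (sym (trans (cong (j % B +_) (m*n%n≡0 n B)) (trans (+-identityʳ _) (m<n⇒m%n≡m j<B)))) j<B

  digitSum-step : ∀ n j → j < B → s (B * n + j) ≡ j + s n
  digitSum-step n j j<B = begin
    digitSumFuel B N N                     ≡⟨ digitSumFuel-enough N (suc N) N ≤-refl (n≤1+n N) ⟩
    N % B + digitSumFuel B N (N / B)       ≡⟨ cong₂ (λ r q → r + digitSumFuel B N q) ([B*n+j]%B≡j n j j<B) ([B*n+j]/B≡n n j j<B) ⟩
    j + digitSumFuel B N n                 ≡⟨ cong (j +_) (digitSumFuel-enough N n n (≤-trans (m≤m+n n _) (m≤m+n (B * n) j)) ≤-refl) ⟩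
    j + s n                                ∎
    where
    open ≡-Reasoning
    N : ℕ
    N = B * n + j

  digitSum-concat : ∀ K q r → r < B ^ K → s (B ^ K * q + r) ≡ s q + s r
  digitSum-concat zero    q zero    _ = trans (cong s (trans (+-identityʳ _) (+-identityʳ q))) (sym (+-identityʳ (s q)))
  digitSum-concat zero    q (suc r) (s≤s ())
  digitSum-concat (suc K) q r r<B^K with division B r
  ... | r′ , j , j<B , refl = begin
    s (B ^ suc K * q + (B * r′ + j))   ≡⟨ cong s (regroup B (B ^ K) q r′ j) ⟩
    s (B * (B ^ K * q + r′) + j)       ≡⟨ digitSum-step (B ^ K * q + r′) j j<B ⟩
    j + s (B ^ K * q + r′)             ≡⟨ cong (j +_) (digitSum-concat K q r′ r′<B^K) ⟩
    j + (s q + s r′)                   ≡⟨ exchange j (s q) (s r′) ⟩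
    s q + (j + s r′)                   ≡⟨ cong (s q +_) (digitSum-step r′ j j<B) ⟨
    s q + s (B * r′ + j)               ∎
    where
    open ≡-Reasoning
    regroup : ∀ B P q r j → B * P * q + (B * r + j) ≡ B * (P * q + r) + j
    regroup = solve-∀
    exchange : ∀ a b c → a + (b + c) ≡ b + (a + c)
    exchange = solve-∀
    r′<B^K : r′ < B ^ K
    r′<B^K = *-cancelˡ-< B r′ (B ^ K) (≤-<-trans (m≤m+n (B * r′) j) r<B^K)

  tb2-step : ∀ n j → j < B → t (B * n + j) ≡ (j + s n) % 2
  tb2-step n j j<B = cong (_% 2) (digitSum-step n j j<B)

  -- Adding B^K, with K so large that B^K exceeds the positions considered, adds the digit 1.
  tb2-complement : ∀ i m → ∃ λ i′ → ∀ k → k < m → t (i′ + k) ≡ 1 ∸ t (i + k)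
  tb2-complement i m = B ^ K + i , λ k k<m → begin
    t (B ^ K + i + k)                                     ≡⟨ cong t (regroup (B ^ K) i k) ⟩
    s (B ^ K * 1 + (i + k)) % 2                           ≡⟨ cong (_% 2) (digitSum-concat K 1 (i + k) (fits k k<m)) ⟩
    (s 1 + s (i + k)) % 2                                 ≡⟨ cong (λ z → (z + s (i + k)) % 2) s1≡1 ⟩
    suc (s (i + k)) % 2                                   ≡⟨ m+n∸n≡m _ (s (i + k) % 2) ⟨
    suc (s (i + k)) % 2 + s (i + k) % 2 ∸ s (i + k) % 2   ≡⟨ cong (_∸ s (i + k) % 2) ([1+m]%2+m%2≡1 (s (i + k))) ⟩
    1 ∸ t (i + k)                                         ∎
    where
    open ≡-Reasoning
    K : ℕ
    K = i + m
    regroup : ∀ P i k → P + i + k ≡ P * 1 + (i + k)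
    regroup = solve-∀
    s1≡1 : s 1 ≡ 1
    s1≡1 = trans (cong s (cong (_+ 1) (sym (*-zeroʳ B)))) (digitSum-step 0 1 (s≤s z<s))
    fits : ∀ k → k < m → i + k < B ^ K
    fits k k<m = ≤-trans (+-monoʳ-< i k<m) (<⇒≤ (n<[2+d]^n d K))

  v : Word∞
  v = S t

  v≡ : ∀ n → v n ≡ (s n + s (suc n)) % 2
  v≡ n = sym (%-distribˡ-+ (s n) (s (suc n)) 2)

  v-block-ones : ∀ n j → j < suc d → v (B * n + j) ≡ 1
  v-block-ones n j j<c = begin
    (t (B * n + j) + t (suc (B * n + j))) % 2        ≡⟨ cong (λ z → (t (B * n + j) + t z) % 2) (sym (+-suc (B * n) j)) ⟩
    (t (B * n + j) + t (B * n + suc j)) % 2          ≡⟨ cong₂ (λ p q → (p + q) % 2) (tb2-step n j (m<n⇒m<1+n j<c)) (tb2-step n (suc j) (s≤s j<c)) ⟩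
    ((j + s n) % 2 + (suc j + s n) % 2) % 2          ≡⟨ cong (_% 2) (trans (+-comm ((j + s n) % 2) _) ([1+m]%2+m%2≡1 (j + s n))) ⟩
    1                                                ∎
    where open ≡-Reasoning

  v-hole : ∀ n → v (B * n + suc d) ≡ (suc (d % 2) + (s n + s (suc n))) % 2
  v-hole n = begin
    (t (B * n + suc d) + t (suc (B * n + suc d))) % 2       ≡⟨ cong₂ (λ p q → (p + q) % 2) (tb2-step n (suc d) ≤-refl)
                                                                  (trans (cong t (next-block d n)) (tb2-step (suc n) 0 z<s)) ⟩
    ((suc d + s n) % 2 + s (suc n) % 2) % 2                 ≡⟨ %-distribˡ-+ (suc d + s n) (s (suc n)) 2 ⟨
    (suc d + s n + s (suc n)) % 2                           ≡⟨ cong (_% 2) (split-d (d % 2) (d / 2) (s n) (s (suc n)) (m≡m%n+[m/n]*n d 2)) ⟩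
    (suc (d % 2) + (s n + s (suc n)) + d / 2 * 2) % 2       ≡⟨ [m+kn]%n≡m%n (suc (d % 2) + (s n + s (suc n))) (d / 2) 2 ⟩
    (suc (d % 2) + (s n + s (suc n))) % 2                   ∎
    where
    open ≡-Reasoning
    next-block : ∀ d n → suc (suc (suc d) * n + suc d) ≡ suc (suc d) * suc n + 0
    next-block = solve-∀
    split-d : ∀ r q A D → d ≡ r + q * 2 → suc d + A + D ≡ suc r + (A + D) + q * 2
    split-d r q A D refl = rearrange r q A D
      where
      rearrange : ∀ r q A D → suc (r + q * 2) + A + D ≡ suc r + (A + D) + q * 2
      rearrange = solve-∀

  v-period-doubling : d % 2 ≡ 0 → PeriodDoubling d v
  v-period-doubling d-even = record
    { block-ones = v-block-ones
    ; hole-flips = λ n → trans (cong₂ _+_ (trans (v-hole n) (cong (λ r → (suc r + (s n + s (suc n))) % 2) d-even)) (v≡ n))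
                                 ([1+m]%2+m%2≡1 (s n + s (suc n)))
    }

  v-ones : d % 2 ≡ 1 → ∀ n → v n ≡ 1
  v-ones d-odd = <-rec (λ n → v n ≡ 1) step
    where
    step : ∀ n → (∀ {k} → k < n → v k ≡ 1) → v n ≡ 1
    step p ih with division B p
    ... | n , j , j<B , refl with m≤n⇒m<n∨m≡n (≤-pred j<B)
    ...   | inj₁ j<c = v-block-ones n j j<c
    ...   | inj₂ refl = begin
      v (B * n + suc d)                              ≡⟨ v-hole n ⟩
      (suc (d % 2) + (s n + s (suc n))) % 2          ≡⟨ cong (λ r → (suc r + (s n + s (suc n))) % 2) d-odd ⟩
      (2 + (s n + s (suc n))) % 2                    ≡⟨ cong (_% 2) (+-comm 2 (s n + s (suc n))) ⟩
      (s n + s (suc n) + 2) % 2                      ≡⟨ [m+n]%n≡m%n (s n + s (suc n)) 2 ⟩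
      (s n + s (suc n)) % 2                          ≡⟨ v≡ n ⟨
      v n                                            ≡⟨ ih n<p ⟩
      1                                              ∎
      where
      open ≡-Reasoning
      n<p : n < B * n + suc d
      n<p = subst (n <_) (sym (+-suc (B * n) d)) (s≤s (≤-trans (m≤m+n n (suc d * n)) (m≤m+n (B * n) d)))

-- Factor complexity of S

FactorsOfLength : Word∞ → ℕ → List Word → Set
FactorsOfLength x m L = Unique L × (∀ w → (w ∈ L) ⇔ (length w ≡ m × IsFactor∞ w x))

factors-of-length : ∀ x m bound → OccursBefore x m bound → Σ (List Word) (FactorsOfLength x m)
factors-of-length x m bound early = L , deduplicate-! _ (map at-index (upTo bound)) , λ w → mk⇔ to from
  where
  at-index : ℕ → Word
  at-index i = slice x i m
  L : List Word
  L = deduplicate (≡-dec _≟_) (map at-index (upTo bound))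
  to : ∀ {w} → w ∈ L → length w ≡ m × IsFactor∞ w x
  to w∈L with ∈-map⁻ at-index (∈-deduplicate⁻ (≡-dec _≟_) (map at-index (upTo bound)) w∈L)
  ... | i , _ , refl = length-slice x i m , IsFactor∞-slice refl
  from : ∀ {w} → length w ≡ m × IsFactor∞ w x → w ∈ L
  from {w} (refl , i , occ) with early i
  ... | i′ , i′<bound , same = ∈-deduplicate⁺ (≡-dec _≟_)
    (subst (_∈ map at-index (upTo bound)) (trans (sym (SameFactor⇒slice≡ x i i′ (length w) same)) occ)
      (∈-map⁺ at-index (∈-upTo⁺ i′<bound)))

Unique-map⁺-on : ∀ {f : Word → Word} {xs : List Word} → (∀ {u w} → u ∈ xs → w ∈ xs → f u ≡ f w → u ≡ w) →
  Unique xs → Unique (map f xs)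
Unique-map⁺-on {xs = []}     _   _              = []
Unique-map⁺-on {xs = u ∷ xs} inj (u∉xs ∷ unique) =
  All.map⁺ (All.tabulate λ w∈xs fu≡fw → All.lookup u∉xs w∈xs (inj (here refl) (there w∈xs) fu≡fw))
  ∷ Unique-map⁺-on (λ u∈ w∈ → inj (there u∈) (there w∈)) unique

Bit : ℕ → Set
Bit y = y ≡ 0 ⊎ y ≡ 1

partialSums : ℕ → Word → Word
partialSums a []      = []
partialSums a (y ∷ w) = (a + y) % 2 ∷ partialSums ((a + y) % 2) w

-- Inverse of S once the first letter a is fixed.
integrate : ℕ → Word → Word
integrate a w = a ∷ partialSums a w

length-integrate : ∀ a w → length (integrate a w) ≡ suc (length w)
length-integrate a []      = refl
length-integrate a (y ∷ w) = cong suc (length-integrate _ w)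

[1+a]%2≢a%2 : ∀ a → suc a % 2 ≢ a % 2
[1+a]%2≢a%2 zero          ()
[1+a]%2≢a%2 (suc zero)    ()
[1+a]%2≢a%2 (suc (suc a)) = [1+a]%2≢a%2 a

+-%2-cancelˡ : ∀ a {y y′} → Bit y → Bit y′ → (a + y) % 2 ≡ (a + y′) % 2 → y ≡ y′
+-%2-cancelˡ a (inj₁ refl) (inj₁ refl) _  = refl
+-%2-cancelˡ a (inj₂ refl) (inj₂ refl) _  = refl
+-%2-cancelˡ a (inj₁ refl) (inj₂ refl) eq = ⊥-elim ([1+a]%2≢a%2 a (subst₂ (λ p q → p % 2 ≡ q % 2) (+-comm a 1) (+-identityʳ a) (sym eq)))
+-%2-cancelˡ a (inj₂ refl) (inj₁ refl) eq = ⊥-elim ([1+a]%2≢a%2 a (subst₂ (λ p q → p % 2 ≡ q % 2) (+-comm a 1) (+-identityʳ a) eq))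

partialSums-injective : ∀ a {u w} → All Bit u → All Bit w → partialSums a u ≡ partialSums a w → u ≡ w
partialSums-injective a []           []             _  = refl
partialSums-injective a (by ∷ bits) (by′ ∷ bits′) eq
  with +-%2-cancelˡ a by by′ (∷-injectiveˡ eq)
... | refl = cong (_ ∷_) (partialSums-injective _ bits bits′ (∷-injectiveʳ eq))

%2-bit : ∀ m → Bit (m % 2)
%2-bit zero          = inj₁ refl
%2-bit (suc zero)    = inj₂ refl
%2-bit (suc (suc m)) = %2-bit m

module Derivative (t : Word∞) (t-binary : ∀ n → Bit (t n))
                  (complement : ∀ i m → ∃ λ i′ → ∀ k → k < m → t (i′ + k) ≡ 1 ∸ t (i + k)) where

  factor-binary : ∀ {w} → IsFactor∞ w (S t) → All Bit w
  factor-binary {w} (i , occ) = subst (All Bit) occ (slice-binary i (length w))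
    where
    slice-binary : ∀ i m → All Bit (slice (S t) i m)
    slice-binary i zero    = []
    slice-binary i (suc m) = %2-bit (t i + t (suc i)) ∷ slice-binary (suc i) m

  partialSums-S : ∀ i m → partialSums (t i) (slice (S t) i m) ≡ slice t (suc i) m
  partialSums-S i zero    = refl
  partialSums-S i (suc m) = cong₂ _∷_ next (trans (cong (λ a → partialSums a (slice (S t) (suc i) m)) next) (partialSums-S (suc i) m))
    where
    recover : ∀ {a b} → Bit a → Bit b → (a + (a + b) % 2) % 2 ≡ b
    recover (inj₁ refl) (inj₁ refl) = refl
    recover (inj₁ refl) (inj₂ refl) = refl
    recover (inj₂ refl) (inj₁ refl) = refl
    recover (inj₂ refl) (inj₂ refl) = refl
    next : (t i + S t i) % 2 ≡ t (suc i)
    next = recover (t-binary i) (t-binary (suc i))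

  S-complement : ∀ i i′ m → (∀ k → k < suc m → t (i′ + k) ≡ 1 ∸ t (i + k)) → slice (S t) i m ≡ slice (S t) i′ m
  S-complement i i′ m flipped = SameFactor⇒slice≡ (S t) i i′ m λ k k<m →
    flip-both (t-binary (i + k)) (t-binary (suc (i + k))) (flipped k (m<n⇒m<1+n k<m))
      (trans (cong t (sym (+-suc i′ k))) (trans (flipped (suc k) (s≤s k<m)) (cong (λ z → 1 ∸ t z) (+-suc i k))))
    where
    flip-both : ∀ {a b a′ b′} → Bit a → Bit b → a′ ≡ 1 ∸ a → b′ ≡ 1 ∸ b → (a + b) % 2 ≡ (a′ + b′) % 2
    flip-both (inj₁ refl) (inj₁ refl) refl refl = refl
    flip-both (inj₁ refl) (inj₂ refl) refl refl = refl
    flip-both (inj₂ refl) (inj₁ refl) refl refl = refl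
    flip-both (inj₂ refl) (inj₂ refl) refl refl = refl

  integrate-factor : ∀ a → Bit a → ∀ i m → IsFactor∞ (integrate a (slice (S t) i m)) t
  integrate-factor a a-bit i m with same-or-flipped a-bit (t-binary i)
    where
    same-or-flipped : ∀ {a b} → Bit a → Bit b → a ≡ b ⊎ a ≡ 1 ∸ b
    same-or-flipped (inj₁ refl) (inj₁ refl) = inj₁ refl
    same-or-flipped (inj₁ refl) (inj₂ refl) = inj₂ refl
    same-or-flipped (inj₂ refl) (inj₁ refl) = inj₂ refl
    same-or-flipped (inj₂ refl) (inj₂ refl) = inj₁ refl
  ... | inj₁ refl = IsFactor∞-slice (sym (cong (t i ∷_) (partialSums-S i m)))
  ... | inj₂ refl with complement i (suc m)
  ...   | i′ , flipped = IsFactor∞-slice (sym (trans (cong₂ integrate t-i′ (S-complement i i′ m flipped))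
                                                    (cong (t i′ ∷_) (partialSums-S i′ m))))
    where
    t-i′ : 1 ∸ t i ≡ t i′
    t-i′ = sym (trans (cong t (sym (+-identityʳ i′))) (trans (flipped 0 z<s) (cong (λ z → 1 ∸ t z) (+-identityʳ i))))

  integrated : List Word → List Word
  integrated L = map (integrate 0) L ++ map (integrate 1) L

  length-integrated : ∀ L → length (integrated L) ≡ 2 * length L
  length-integrated L = trans (length-++ (map (integrate 0) L))
    (trans (cong₂ _+_ (length-map (integrate 0) L) (length-map (integrate 1) L)) (cong (length L +_) (sym (+-identityʳ (length L)))))

  integrated-factors : ∀ m L → FactorsOfLength (S t) m L → FactorsOfLength t (suc m) (integrated L)
  integrated-factors m L (unique , iff) = unique′ , λ u → mk⇔ to (from u)
    where
    binary : ∀ {w} → w ∈ L → All Bit w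
    binary w∈L = factor-binary (proj₂ (Equivalence.to (iff _) w∈L))
    injective : ∀ a {u w} → u ∈ L → w ∈ L → integrate a u ≡ integrate a w → u ≡ w
    injective a u∈L w∈L eq = partialSums-injective a (binary u∈L) (binary w∈L) (∷-injectiveʳ eq)
    unique′ : Unique (integrated L)
    unique′ = ++⁺ (Unique-map⁺-on (injective 0) unique) (Unique-map⁺-on (injective 1) unique) λ (p , q) → heads-differ p q
      where
      heads-differ : ∀ {u} → u ∈ map (integrate 0) L → u ∈ map (integrate 1) L → ⊥
      heads-differ p q with ∈-map⁻ (integrate 0) p | ∈-map⁻ (integrate 1) q
      ... | _ , _ , refl | _ , _ , eq with ∷-injectiveˡ eq
      ... | ()
    integrated-factor : ∀ a → Bit a → ∀ {u} → u ∈ map (integrate a) L → length u ≡ suc m × IsFactor∞ u t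
    integrated-factor a a-bit u∈ with ∈-map⁻ (integrate a) u∈
    ... | w , w∈L , refl with Equivalence.to (iff w) w∈L
    ...   | refl , i , occ = length-integrate a w ,
                             subst (λ v → IsFactor∞ (integrate a v) t) occ (integrate-factor a a-bit i (length w))
    to : ∀ {u} → u ∈ integrated L → length u ≡ suc m × IsFactor∞ u t
    to u∈ = [ integrated-factor 0 (inj₁ refl) , integrated-factor 1 (inj₂ refl) ]′ (∈-++⁻ (map (integrate 0) L) u∈)
    from : ∀ u → length u ≡ suc m × IsFactor∞ u t → u ∈ integrated L
    from u (len , i , occ) = place (t-binary i)
      where
      u≡ : u ≡ integrate (t i) (slice (S t) i m)
      u≡ = trans (sym occ) (trans (cong (slice t i) len) (cong (t i ∷_) (sym (partialSums-S i m))))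
      w : Word
      w = slice (S t) i m
      w∈L : w ∈ L
      w∈L = Equivalence.from (iff w) (length-slice (S t) i m , IsFactor∞-slice refl)
      place : Bit (t i) → u ∈ integrated L
      place (inj₁ t-i≡0) = ∈-++⁺ˡ (subst (_∈ map (integrate 0) L) (trans (cong (λ a → integrate a w) (sym t-i≡0)) (sym u≡))
                              (∈-map⁺ (integrate 0) w∈L))
      place (inj₂ t-i≡1) = ∈-++⁺ʳ (map (integrate 0) L) (subst (_∈ map (integrate 1) L)
                              (trans (cong (λ a → integrate a w) (sym t-i≡1)) (sym u≡)) (∈-map⁺ (integrate 1) w∈L))

  complexity-S : ∀ m bound → OccursBefore (S t) m bound → ∃ λ k → Complexity (S t) m k × Complexity t (suc m) (2 * k)
  complexity-S m bound early with factors-of-length (S t) m bound early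
  ... | L , unique , iff with integrated-factors m L (unique , iff)
  ...   | unique′ , iff′ = length L , (L , unique , refl , iff) , (integrated L , unique′ , length-integrated L , iff′)

module _ (d : ℕ) where

  open BaseDigits d

  S-tb2-rich-and-recurrent : RRich v × (∀ m → ∃ (OccursBefore v m))
  S-tb2-rich-and-recurrent with %2-bit d
  ... | inj₁ d-even = complete-returns⇒rich v (PeriodDoublingRichness.complete-returns-palindromic pd) ,
                      PeriodDoublingWord.factors-occur-before pd
    where
    pd : PeriodDoubling d v
    pd = v-period-doubling d-even
  ... | inj₂ d-odd = complete-returns⇒rich v (λ i j ℓ _ _ _ _ → PalindromeOn-constant v i (j + ℓ) 1 λ p _ _ → v-ones d-odd p) ,
                     λ m → 1 , λ i → 0 , z<s , λ k _ → trans (v-ones d-odd (i + k)) (sym (v-ones d-odd k))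

mainTheorem16 : (b : ℕ) → .{{_ : NonZero b}} → 2 ≤ b →
    RRich (S (tb2 b)) ×
    (∀ n → 1 ≤ n → ∃ λ k → Complexity (S (tb2 b)) n k × Complexity (tb2 b) (suc n) (2 * k))
mainTheorem16 (suc (suc d)) (s≤s (s≤s z≤n)) =
  proj₁ rich-recurrent , λ n _ → complexity-S n _ (proj₂ (proj₂ rich-recurrent n))
  where
  open BaseDigits d
  open Derivative t (λ n → %2-bit (s n)) tb2-complement
  rich-recurrent : RRich v × (∀ m → ∃ (OccursBefore v m))
  rich-recurrent = S-tb2-rich-and-recurrent d
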